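{- Let $n\ge1$ and $k\ge 1$ be integers with $n\ge 2k-1$. Then $$\mathit{GenF}(n,k)=\{0^i1(01)^{k-1}0^{n-2k+1-i}\ \mid\ 0\le i\le n-2k+1\},$$ and in particular $|\mathit{GenF}(n,k)|=n-2k+2$.
   Context: $F_n(2,k)$ is the set of binary words of length $n$ with exactly $k$ ones and with no two consecutive 1's. Two binary words differ by a homogeneous transposition if one is obtained from the other by transposing a 1 with a 0 with no 1's between the transposed positions. For a set $S$ of same-length, same-weight binary words and $\alpha\in S$, the greedy Gray code algorithm for $S$ applied to $\alpha$ builds a list $\mathcal L$ as follows: initialize $\mathcal L=(\alpha)$; repeatedly, for the last word of $\mathcal L$, homogeneously transpose the leftmost possible 1 with the leftmost possible 0 such that the resulting word is in $S$ but not already in $\mathcal L$, and append it to $\mathcal L$; stop when no such new word exists. $\mathcal{F}(\alpha)$ denotes the list obtained by applying this algorithm for $S=F_n(2,k)$ to $\alpha$. $\mathit{GenF}(n,k)$ is the set of $\alpha\in F_n(2,k)$ such that $\mathcal{F}(\alpha)$ contains every word of $F_n(2,k)$ (equivalently, is a homogeneous Gray code for $F_n(2,k)$). -}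

module Defs where

open import Data.Bool using (Bool; true; false; _∧_; not; if_then_else_)
open import Data.Nat using (ℕ; zero; suc; _+_; _^_; _<ᵇ_)
open import Data.Fin using (Fin; toℕ)
open import Data.List using (List; []; _∷_; concatMap; filter; reverse; allFin)
open import Data.Bool.ListAction using (any; all)
open import Data.Maybe using (Maybe; just; nothing)
open import Data.Vec using (Vec; []; _∷_; lookup; _[_]≔_; toList)
open import Data.Vec.Properties using (≡-dec)
import Data.Bool.Properties as BoolP
open import Data.List.Membership.Propositional using (_∈_)
open import Data.List.Membership.DecPropositional using () renaming (_∈?_ to ∈?-gen)
open import Relation.Nullary using (does)
open import Relation.Binary.PropositionalEquality using (_≡_)
open import Data.Product using (_×_)

-- Binary words of length n (true = 1, false = 0).
Word : ℕ → Set
Word n = Vec Bool n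

weight : ∀ {n} → Word n → ℕ
weight [] = 0
weight (true ∷ w) = suc (weight w)
weight (false ∷ w) = weight w

noAdj : List Bool → Bool
noAdj (true ∷ true ∷ _) = false
noAdj (_ ∷ w) = noAdj w
noAdj [] = true

inFᵇ : ∀ {n} → ℕ → Word n → Bool
inFᵇ k w = does (weight w Data.Nat.≟ k) ∧ noAdj (toList w)

InF : (n k : ℕ) → Word n → Set
InF n k w = (weight w ≡ k) × (noAdj (toList w) ≡ true)

allWords : (n : ℕ) → List (Word n)
allWords zero = [] ∷ []
allWords (suc n) = concatMap (λ w → (false ∷ w) ∷ (true ∷ w) ∷ []) (allWords n)

_≟w_ : ∀ {n} → (u v : Word n) → Relation.Nullary.Dec (u ≡ v)
_≟w_ = ≡-dec BoolP._≟_

memᵇ : ∀ {n} → Word n → List (Word n) → Bool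
memᵇ w L = does (∈?-gen _≟w_ w L)

noOneBetween : ∀ {n} → Word n → Fin n → Fin n → Bool
noOneBetween {n} w i j =
  not (any (λ m → ((toℕ i <ᵇ toℕ m) ∧ (toℕ m <ᵇ toℕ j) ∨ᵇ (toℕ j <ᵇ toℕ m) ∧ (toℕ m <ᵇ toℕ i))
                  ∧ lookup w m)
           (allFin n))
  where
    _∨ᵇ_ : Bool → Bool → Bool
    true ∨ᵇ _ = true
    false ∨ᵇ b = b
    infixr 5 _∨ᵇ_

-- Homogeneous transpositions of w (1 at position i with 0 at position j,
-- no 1 between them), listed in the greedy priority order: leftmost 1
-- first, then leftmost 0.
homTranspositions : ∀ {n} → Word n → List (Word n)
homTranspositions {n} w =
  concatMap (λ i → concatMap (λ j →
     if lookup w i ∧ not (lookup w j) ∧ noOneBetween w i j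
     then ((w [ i ]≔ false) [ j ]≔ true) ∷ []
     else []) (allFin n)) (allFin n)

firstNew : ∀ {n} → ℕ → List (Word n) → List (Word n) → Maybe (Word n)
firstNew k [] L = nothing
firstNew k (c ∷ cs) L =
  if inFᵇ k c ∧ not (memᵇ c L) then just c else firstNew k cs L

-- greedy loop; the list is kept reversed (last word at the head).
-- Fuel: each step adds a new word of length n, so 2^n steps suffice.
greedyLoop : ∀ {n} → ℕ → ℕ → Word n → List (Word n) → List (Word n)
greedyLoop k zero last Lrev = Lrev
greedyLoop k (suc f) last Lrev with firstNew k (homTranspositions last) Lrev
... | nothing = Lrev
... | just w = greedyLoop k f w (w ∷ Lrev)

greedyF : (n k : ℕ) → Word n → List (Word n)
greedyF n k α = reverse (greedyLoop k (2 ^ n) α (α ∷ []))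

GenF : (n k : ℕ) → Word n → Set
GenF n k α = InF n k α × (∀ (β : Word n) → InF n k β → β ∈ greedyF n k α)

open import Data.List using (replicate; concat; _++_)
open import Data.Nat using (_∸_; _*_)
specialWord : (n k i : ℕ) → List Bool
specialWord n k i =
  replicate i false ++ (true ∷ concat (replicate (k ∸ 1) (false ∷ true ∷ [])))
    ++ replicate (n ∸ (2 * k ∸ 1) ∸ i) false

-- Group the words of F_n(2,k) into levels by their number of trailing 0s: the words of level c are
-- q 0 1 0ᶜ with q a word with one 1 fewer. In the candidate list of such a word the transpositions
-- inside q come first, in the order they have for q, and the moves of the last 1 follow, to the
-- highest level first. So a greedy run entering a level follows the run for q until that one is
-- stuck, and then the last 1 jumps to the highest level still available. By induction on k, the run
-- from a special word 0ⁱ1(01)ᵏ⁻¹0ⁿ⁻²ᵏ⁺¹⁻ⁱ sweeps every level completely before it leaves it (where it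
-- stops is part of the induction hypothesis), hence visits all of F_n(2,k); the run from any other
-- word never gets above its own level, which is below that of 1(01)ᵏ⁻¹0ⁿ⁻²ᵏ⁺¹.
module Submission where

open import Defs
open import Data.Bool using (Bool; true; false; _∧_; _∨_; not; if_then_else_)
open import Data.Bool.ListAction using (any; or; all)
open import Data.Empty using (⊥; ⊥-elim)
open import Data.Fin using (Fin; toℕ; fromℕ<)
open import Data.Fin.Properties using (toℕ-injective; toℕ<n; toℕ-fromℕ<)
open import Data.List using (List; []; _∷_; _++_; map; concat; concatMap; length; replicate; upTo; applyUpTo; tabulate; allFin; filterᵇ; downFrom)
open import Data.List.Membership.Propositional using (_∈_; _∉_; find)
open import Data.List.Membership.Propositional.Properties using (∈-map⁺; ∈-map⁻; ∈-filter⁻; ∈-concatMap⁻; ∈-upTo⁺; ∈-upTo⁻; ∈-applyUpTo⁻; ∈-++⁺ˡ; ∈-++⁺ʳ; ∈-++⁻; ∈-allFin)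
open import Data.List.Properties using (map-tabulate; tabulate-cong; map-upTo; map-concatMap; ≡-dec; map-applyUpTo; ++-assoc; length-++; length-replicate; filter-++; concatMap-++; ++-identityʳ; ++-cancelʳ; length-map; length-tabulate)
open import Data.List.Relation.Binary.Subset.Propositional using (_⊆_)
open import Data.List.Relation.Unary.All using (All)
open import Data.List.Relation.Unary.Any using (here; there; satisfied)
open import Data.List.Relation.Unary.Unique.Propositional using (Unique)
open import Data.List.Relation.Unary.Unique.Propositional.Properties using (map⁺; allFin⁺)
open import Data.Maybe using (Maybe; just; nothing)
open import Data.Maybe.Properties using (just-injective)
open import Data.Nat using (ℕ; zero; suc; _+_; _^_; _<ᵇ_; _≤_; z≤n; s≤s; pred; _∸_; _<_; _≡ᵇ_; _*_)
open import Data.Nat.Induction using (<-wellFounded)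
open import Data.Nat.Properties
open import Data.Nat.Tactic.RingSolver using (solve-∀)
open import Data.Product using (Σ; ∃; _×_; _,_; proj₁; proj₂; map₁; ∃₂; ∃-syntax)
open import Data.Sum using (inj₁; inj₂; _⊎_; [_,_]′)
open import Data.Vec using (Vec; toList; lookup; fromList; cast)
open import Data.Vec.Properties using (length-toList; toList-injective; toList-cast; toList∘fromList)
open import Data.Vec.Relation.Binary.Equality.Cast using (cast-is-id)
open import Function using (_∘_; id; case_of_)
open import Function.Bundles using (Equivalence; _⇔_; mk⇔)
open import Induction.WellFounded using (Acc; acc)
open import Relation.Binary.Definitions using (tri<; tri≈; tri>)
open import Relation.Binary.PropositionalEquality
open import Relation.Nullary using (Dec; yes; no; does; ¬_)
open import Relation.Nullary.Decidable using (dec-true; does-≡; map′)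
import Data.Bool.Properties as Bool
import Data.Fin as Fin
import Data.List.Membership.DecPropositional as DecMembership
import Data.List.Relation.Unary.All as All
import Data.List.Relation.Unary.AllPairs as AllPairs
import Data.List.Relation.Unary.Any.Properties as Any
import Data.Maybe as Maybe
import Data.Sum as Sum
import Data.Vec as Vec

-- The greedy algorithm on lists of bits; ᴸ marks the list versions of the definitions in Defs.

infixl 9 _!_
_!_ : List Bool → ℕ → Bool
[] ! _ = false
(x ∷ xs) ! zero = x
(x ∷ xs) ! suc i = xs ! i

_[_]≔_ : List Bool → ℕ → Bool → List Bool
[] [ _ ]≔ _ = []
(x ∷ xs) [ zero ]≔ b = b ∷ xs
(x ∷ xs) [ suc i ]≔ b = x ∷ (xs [ i ]≔ b)

weightᴸ : List Bool → ℕ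
weightᴸ [] = 0
weightᴸ (true ∷ w) = suc (weightᴸ w)
weightᴸ (false ∷ w) = weightᴸ w

between : ℕ → ℕ → ℕ → Bool
between i j m = ((i <ᵇ m) ∧ (m <ᵇ j)) ∨ ((j <ᵇ m) ∧ (m <ᵇ i))

noOneBetweenᴸ : List Bool → ℕ → ℕ → Bool
noOneBetweenᴸ w i j = not (any (λ m → between i j m ∧ w ! m) (upTo (length w)))

transposition : List Bool → ℕ → ℕ → List (List Bool)
transposition w i j =
  if w ! i ∧ not (w ! j) ∧ noOneBetweenᴸ w i j then (w [ i ]≔ false) [ j ]≔ true ∷ [] else []

transpositionsFrom : List Bool → ℕ → List (List Bool)
transpositionsFrom w i = concatMap (transposition w i) (upTo (length w))

homTranspositionsᴸ : List Bool → List (List Bool)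
homTranspositionsᴸ w = concatMap (transpositionsFrom w) (upTo (length w))

inFᴸ : ℕ → List Bool → Bool
inFᴸ k w = does (weightᴸ w Data.Nat.≟ k) ∧ noAdj w

candidates : ℕ → List Bool → List (List Bool)
candidates k w = filterᵇ (inFᴸ k) (homTranspositionsᴸ w)

_≟ᴸ_ : (u v : List Bool) → Dec (u ≡ v)
_≟ᴸ_ = ≡-dec Bool._≟_

open DecMembership _≟ᴸ_ using (_∈?_)

firstNewᴸ : List (List Bool) → List (List Bool) → Maybe (List Bool)
firstNewᴸ [] V = nothing
firstNewᴸ (c ∷ cs) V = if does (c ∈? V) then firstNewᴸ cs V else just c

-- GreedyRun k x V e R: the greedy algorithm for F(2,k), whose list so far is V
-- (reversed, so its last word x is at the head), stops with last word e and list R.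
data GreedyRun (k : ℕ) : List Bool → List (List Bool) → List Bool → List (List Bool) → Set where
  stop : ∀ {x V} → firstNewᴸ (candidates k x) V ≡ nothing → GreedyRun k x V x V
  step : ∀ {x V y e R} → firstNewᴸ (candidates k x) V ≡ just y → GreedyRun k y (y ∷ V) e R →
         GreedyRun k x V e R

steps : ∀ {k x V e R} → GreedyRun k x V e R → ℕ
steps (stop _) = 0
steps (step _ r) = suc (steps r)

-- Agreement with the definitions on vectors

tabulate-toℕ : ∀ {A : Set} {n} (g : ℕ → A) → tabulate {n = n} (g ∘ toℕ) ≡ applyUpTo g n
tabulate-toℕ {n = zero} g = refl
tabulate-toℕ {n = suc n} g = cong (g 0 ∷_) (tabulate-toℕ (g ∘ suc))

map-allFin : ∀ {A : Set} {n} (f : Fin n → A) (g : ℕ → A) → (∀ i → f i ≡ g (toℕ i)) →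
             map f (allFin n) ≡ map g (upTo n)
map-allFin {n = n} f g f≗g = begin
  map f (allFin n)   ≡⟨ map-tabulate id f ⟩
  tabulate f         ≡⟨ tabulate-cong f≗g ⟩
  tabulate (g ∘ toℕ) ≡⟨ tabulate-toℕ g ⟩
  applyUpTo g n      ≡⟨ map-upTo g n ⟨
  map g (upTo n)     ∎
  where open ≡-Reasoning

lookup-toList : ∀ {n} (w : Vec Bool n) i → lookup w i ≡ toList w ! toℕ i
lookup-toList (x Vec.∷ w) Fin.zero = refl
lookup-toList (x Vec.∷ w) (Fin.suc i) = lookup-toList w i

toList-[]≔ : ∀ {n} (w : Vec Bool n) i b → toList (w Vec.[ i ]≔ b) ≡ toList w [ toℕ i ]≔ b
toList-[]≔ (x Vec.∷ w) Fin.zero b = refl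
toList-[]≔ (x Vec.∷ w) (Fin.suc i) b = cong (x ∷_) (toList-[]≔ w i b)

toList-inj : ∀ {n} {v w : Vec Bool n} → toList v ≡ toList w → v ≡ w
toList-inj {v = v} {w} eq = trans (sym (cast-is-id refl v)) (toList-injective refl v w eq)

-- Defs.noOneBetween is written with a local copy of _∨_, which is why its test
-- is only extracted here and compared case by case.
noOneBetween-as-or : ∀ {n} (w : Vec Bool n) i j →
  Σ (Fin n → Bool) λ p → noOneBetween w i j ≡ not (or (map p (allFin n)))
noOneBetween-as-or w i j = _ , refl

noOneBetween-test : ∀ {n} (w : Vec Bool n) i j m →
  proj₁ (noOneBetween-as-or w i j) m ≡ between (toℕ i) (toℕ j) (toℕ m) ∧ toList w ! toℕ m
noOneBetween-test w i j m rewrite lookup-toList w m with toℕ i <ᵇ toℕ m | toℕ m <ᵇ toℕ j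
... | true | true = refl
... | true | false = refl
... | false | _ = refl

noOneBetween-toList : ∀ {n} (w : Vec Bool n) i j →
  noOneBetween w i j ≡ noOneBetweenᴸ (toList w) (toℕ i) (toℕ j)
noOneBetween-toList {n} w i j = trans (proj₂ (noOneBetween-as-or w i j)) (cong (not ∘ or)
  (trans (map-allFin _ q (noOneBetween-test w i j)) (cong (λ m → map q (upTo m)) (sym (length-toList w)))))
  where q = λ m → between (toℕ i) (toℕ j) m ∧ toList w ! m

transposition-toList : ∀ {n} (w : Vec Bool n) i j →
  map toList (if lookup w i ∧ not (lookup w j) ∧ noOneBetween w i j
              then (w Vec.[ i ]≔ false) Vec.[ j ]≔ true ∷ [] else [])
  ≡ transposition (toList w) (toℕ i) (toℕ j)
transposition-toList w i j
  rewrite lookup-toList w i | lookup-toList w j | noOneBetween-toList w i j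
  with toList w ! toℕ i ∧ not (toList w ! toℕ j) ∧ noOneBetweenᴸ (toList w) (toℕ i) (toℕ j)
... | false = refl
... | true = cong (_∷ []) (trans (toList-[]≔ _ j true) (cong (_[ toℕ j ]≔ true) (toList-[]≔ w i false)))

map-concatMap-allFin : ∀ {A B : Set} {n} {F : Fin n → List A} {G : ℕ → List B} {h : A → B} →
  (∀ i → map h (F i) ≡ G (toℕ i)) → map h (concatMap F (allFin n)) ≡ concatMap G (upTo n)
map-concatMap-allFin {n = n} {F} {G} {h} eq = begin
  map h (concatMap F (allFin n))       ≡⟨ map-concatMap h F (allFin n) ⟩
  concat (map (map h ∘ F) (allFin n))  ≡⟨ cong concat (map-allFin (map h ∘ F) G eq) ⟩
  concatMap G (upTo n)                 ∎
  where open ≡-Reasoning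

homTranspositions-toList : ∀ {n} (w : Vec Bool n) → map toList (homTranspositions w) ≡ homTranspositionsᴸ (toList w)
homTranspositions-toList {n} w = trans
  (map-concatMap-allFin {G = transpositionsFrom (toList w)} λ i →
     trans (map-concatMap-allFin {G = transposition (toList w) (toℕ i)} (transposition-toList w i))
           (over-positions _))
  (over-positions _)
  where
  over-positions : ∀ {A : Set} (G : ℕ → List A) → concatMap G (upTo n) ≡ concatMap G (upTo (length (toList w)))
  over-positions G = cong (concatMap G ∘ upTo) (sym (length-toList w))

weight-toList : ∀ {n} (w : Vec Bool n) → weight w ≡ weightᴸ (toList w)
weight-toList Vec.[] = refl
weight-toList (true Vec.∷ w) = cong suc (weight-toList w)
weight-toList (false Vec.∷ w) = weight-toList w

inFᵇ-toList : ∀ {n} k (w : Vec Bool n) → inFᵇ k w ≡ inFᴸ k (toList w)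
inFᵇ-toList k w = cong (λ m → does (m Data.Nat.≟ k) ∧ noAdj (toList w)) (weight-toList w)

∈-map-toList⁻ : ∀ {n} {v : Vec Bool n} {L} → toList v ∈ map toList L → v ∈ L
∈-map-toList⁻ {v = v} {L} m with ∈-map⁻ toList m
... | w , w∈L , eq = subst (_∈ L) (sym (toList-inj eq)) w∈L

memᵇ-toList : ∀ {n} (v : Vec Bool n) L → memᵇ v L ≡ does (toList v ∈? map toList L)
memᵇ-toList v L = does-≡ (DecMembership._∈?_ _≟w_ v L) (map′ ∈-map-toList⁻ (∈-map⁺ toList) (toList v ∈? map toList L))

firstNew-toList : ∀ {n} k (C L : List (Vec Bool n)) →
  Maybe.map toList (firstNew k C L) ≡ firstNewᴸ (filterᵇ (inFᴸ k) (map toList C)) (map toList L)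
firstNew-toList k [] L = refl
firstNew-toList k (c ∷ C) L rewrite inFᵇ-toList k c | memᵇ-toList c L with inFᴸ k (toList c)
... | false = firstNew-toList k C L
... | true with does (toList c ∈? map toList L)
...   | true = firstNew-toList k C L
...   | false = refl

firstNew-homTranspositions : ∀ {n} k (v : Vec Bool n) L →
  Maybe.map toList (firstNew k (homTranspositions v) L) ≡ firstNewᴸ (candidates k (toList v)) (map toList L)
firstNew-homTranspositions k v L = trans (firstNew-toList k (homTranspositions v) L)
  (cong (λ C → firstNewᴸ (filterᵇ (inFᴸ k) C) (map toList L)) (homTranspositions-toList v))

greedyLoop-run : ∀ {n} k {x V e R} (r : GreedyRun k x V e R) f → steps r ≤ f →
  (v : Vec Bool n) (Vs : List (Vec Bool n)) → toList v ≡ x → map toList Vs ≡ V →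
  map toList (greedyLoop k f v Vs) ≡ R
greedyLoop-run k (stop _) zero _ v Vs refl refl = refl
greedyLoop-run k (stop none) (suc f) _ v Vs refl refl with firstNew k (homTranspositions v) Vs in found
... | nothing = refl
... | just w = case trans (sym (cong (Maybe.map toList) found)) (trans (firstNew-homTranspositions k v Vs) none) of λ ()
greedyLoop-run k (step {y = y} next r) (suc f) (s≤s le) v Vs refl refl with firstNew k (homTranspositions v) Vs in found
... | nothing = case trans (sym next) (trans (sym (firstNew-homTranspositions k v Vs)) (cong (Maybe.map toList) found)) of λ ()
... | just w = greedyLoop-run k r f le w (w ∷ Vs) w≡ (cong (_∷ map toList Vs) w≡)
  where
  w≡ : toList w ≡ y
  w≡ = just-injective (trans (sym (cong (Maybe.map toList) found)) (trans (firstNew-homTranspositions k v Vs) next))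

-- Runs of the greedy algorithm

firstNewᴸ-just : ∀ xs {V y} → firstNewᴸ xs V ≡ just y → y ∈ xs × y ∉ V
firstNewᴸ-just (c ∷ xs) {V} found with c ∈? V
... | yes _ = map₁ there (firstNewᴸ-just xs found)
firstNewᴸ-just (c ∷ xs) {V} refl | no c∉V = here refl , c∉V

firstNewᴸ-nothing : ∀ xs {V} → firstNewᴸ xs V ≡ nothing → xs ⊆ V
firstNewᴸ-nothing (c ∷ xs) {V} none m with c ∈? V | m
... | yes c∈V | here refl = c∈V
... | yes _ | there m′ = firstNewᴸ-nothing xs none m′
firstNewᴸ-nothing (c ∷ xs) {V} () m | no _ | _

firstNewᴸ-++ˡ : ∀ xs ys {V} → xs ⊆ V → firstNewᴸ (xs ++ ys) V ≡ firstNewᴸ ys V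
firstNewᴸ-++ˡ [] ys _ = refl
firstNewᴸ-++ˡ (c ∷ xs) ys {V} xs⊆V with c ∈? V
... | yes _ = firstNewᴸ-++ˡ xs ys (xs⊆V ∘ there)
... | no c∉V = case c∉V (xs⊆V (here refl)) of λ ()

firstNewᴸ-++-just : ∀ xs ys {V y} → firstNewᴸ xs V ≡ just y → firstNewᴸ (xs ++ ys) V ≡ just y
firstNewᴸ-++-just (c ∷ xs) ys {V} found with c ∈? V
... | yes _ = firstNewᴸ-++-just xs ys found
... | no _ = found

firstNewᴸ-∉ : ∀ {x V} xs → x ∉ V → firstNewᴸ (x ∷ xs) V ≡ just x
firstNewᴸ-∉ {x} {V} xs x∉ with x ∈? V
... | yes x∈ = ⊥-elim (x∉ x∈)
... | no _ = refl

firstNewᴸ-∈ : ∀ {x V} xs → x ∈ V → firstNewᴸ (x ∷ xs) V ≡ firstNewᴸ xs V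
firstNewᴸ-∈ {x} {V} xs x∈ with x ∈? V
... | yes _ = refl
... | no x∉ = ⊥-elim (x∉ x∈)

run-⊆ : ∀ {k x V e R} → GreedyRun k x V e R → V ⊆ R
run-⊆ (stop _) = id
run-⊆ (step _ r) = run-⊆ r ∘ there

run-end : ∀ {k x V e R} → GreedyRun k x V e R → firstNewᴸ (candidates k e) R ≡ nothing
run-end (stop none) = none
run-end (step _ r) = run-end r

run-unique : ∀ {k x V e R} → GreedyRun k x V e R → Unique V → Unique R
run-unique (stop _) u = u
run-unique {k} {x} (step next r) u = run-unique r (new AllPairs.∷ u)
  where new = All.tabulate λ m eq → proj₂ (firstNewᴸ-just (candidates k x) next) (subst (_∈ _) (sym eq) m)

run-length : ∀ {k x V e R} (r : GreedyRun k x V e R) → length R ≡ steps r + length V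
run-length (stop _) = refl
run-length (step _ r) = trans (run-length r) (+-suc _ _)

length-[]≔ : ∀ w i b → length (w [ i ]≔ b) ≡ length w
length-[]≔ [] i b = refl
length-[]≔ (x ∷ w) zero b = refl
length-[]≔ (x ∷ w) (suc i) b = cong suc (length-[]≔ w i b)

∈-transposition : ∀ w i j {y} → y ∈ transposition w i j → y ≡ (w [ i ]≔ false) [ j ]≔ true
∈-transposition w i j m with w ! i ∧ not (w ! j) ∧ noOneBetweenᴸ w i j | m
... | true | here eq = eq

candidates-length : ∀ {k x y} → y ∈ candidates k x → length y ≡ length x
candidates-length {k} {x} {y} m
  with i , m′ ← satisfied (∈-concatMap⁻ (transpositionsFrom x) {xs = upTo (length x)} (proj₁ (∈-filter⁻ _ m)))
  with j , m″ ← satisfied (∈-concatMap⁻ (transposition x i) {xs = upTo (length x)} m′)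
  rewrite ∈-transposition x i j m″ = trans (length-[]≔ (x [ i ]≔ false) j true) (length-[]≔ x i false)

run-wordLengths : ∀ {k n x V e R} → GreedyRun k x V e R → length x ≡ n →
  All (λ z → length z ≡ n) V → All (λ z → length z ≡ n) R
run-wordLengths (stop _) _ lengths = lengths
run-wordLengths {k} {x = x} (step next r) ∣x∣ lengths = run-wordLengths r ∣y∣ (∣y∣ All.∷ lengths)
  where ∣y∣ = trans (candidates-length {k} {x} (proj₁ (firstNewᴸ-just (candidates k x) next))) ∣x∣

tailsWith : Bool → List (List Bool) → List (List Bool)
tailsWith b [] = []
tailsWith b ([] ∷ xs) = tailsWith b xs
tailsWith false ((false ∷ t) ∷ xs) = t ∷ tailsWith false xs
tailsWith false ((true ∷ t) ∷ xs) = tailsWith false xs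
tailsWith true ((false ∷ t) ∷ xs) = tailsWith true xs
tailsWith true ((true ∷ t) ∷ xs) = t ∷ tailsWith true xs

∈-tailsWith⁻ : ∀ b {xs t} → t ∈ tailsWith b xs → b ∷ t ∈ xs
∈-tailsWith⁻ b {[] ∷ xs} m = there (∈-tailsWith⁻ b m)
∈-tailsWith⁻ false {(false ∷ _) ∷ xs} (here refl) = here refl
∈-tailsWith⁻ false {(false ∷ _) ∷ xs} (there m) = there (∈-tailsWith⁻ false m)
∈-tailsWith⁻ false {(true ∷ _) ∷ xs} m = there (∈-tailsWith⁻ false m)
∈-tailsWith⁻ true {(false ∷ _) ∷ xs} m = there (∈-tailsWith⁻ true m)
∈-tailsWith⁻ true {(true ∷ _) ∷ xs} (here refl) = here refl
∈-tailsWith⁻ true {(true ∷ _) ∷ xs} (there m) = there (∈-tailsWith⁻ true m)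

tailsWith-unique : ∀ b {xs} → Unique xs → Unique (tailsWith b xs)
tailsWith-unique b {[]} AllPairs.[] = AllPairs.[]
tailsWith-unique b {[] ∷ xs} (_ AllPairs.∷ u) = tailsWith-unique b u
tailsWith-unique false {(false ∷ t) ∷ xs} (t∉ AllPairs.∷ u) =
  All.tabulate (λ m eq → All.lookup t∉ (∈-tailsWith⁻ false m) (cong (false ∷_) eq)) AllPairs.∷ tailsWith-unique false u
tailsWith-unique false {(true ∷ _) ∷ xs} (_ AllPairs.∷ u) = tailsWith-unique false u
tailsWith-unique true {(false ∷ _) ∷ xs} (_ AllPairs.∷ u) = tailsWith-unique true u
tailsWith-unique true {(true ∷ t) ∷ xs} (t∉ AllPairs.∷ u) =
  All.tabulate (λ m eq → All.lookup t∉ (∈-tailsWith⁻ true m) (cong (true ∷_) eq)) AllPairs.∷ tailsWith-unique true u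

length-tailsWith : ∀ {n xs} → All (λ z → length z ≡ suc n) xs →
  length xs ≡ length (tailsWith false xs) + length (tailsWith true xs)
length-tailsWith All.[] = refl
length-tailsWith {xs = (false ∷ _) ∷ _} (_ All.∷ ls) = cong suc (length-tailsWith ls)
length-tailsWith {xs = (true ∷ _) ∷ _} (_ All.∷ ls) = trans (cong suc (length-tailsWith ls)) (sym (+-suc _ _))

tailsWith-lengths : ∀ b {n xs} → All (λ z → length z ≡ suc n) xs → All (λ z → length z ≡ n) (tailsWith b xs)
tailsWith-lengths b ls = All.tabulate λ m → cong pred (All.lookup ls (∈-tailsWith⁻ b m))

unique-words-length : ∀ n {xs : List (List Bool)} → Unique xs → All (λ z → length z ≡ n) xs → length xs ≤ 2 ^ n
unique-words-length zero {[]} _ _ = z≤n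
unique-words-length zero {_ ∷ []} _ _ = s≤s z≤n
unique-words-length zero {[] ∷ [] ∷ _} ((distinct All.∷ _) AllPairs.∷ _) _ = case distinct refl of λ ()
unique-words-length zero {(_ ∷ _) ∷ _ ∷ _} _ (() All.∷ _)
unique-words-length zero {[] ∷ (_ ∷ _) ∷ _} _ (_ All.∷ () All.∷ _)
unique-words-length (suc n) {xs} u ls = begin
  length xs                                                  ≡⟨ length-tailsWith ls ⟩
  length (tailsWith false xs) + length (tailsWith true xs)  ≤⟨ +-mono-≤ (bound false) (bound true) ⟩
  2 ^ n + 2 ^ n                                              ≡⟨ cong (2 ^ n +_) (+-identityʳ (2 ^ n)) ⟨
  2 ^ suc n                                                  ∎
  where
  open Data.Nat.Properties.≤-Reasoning
  bound : ∀ b → length (tailsWith b xs) ≤ 2 ^ n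
  bound b = unique-words-length n (tailsWith-unique b u) (tailsWith-lengths b ls)

-- Indexing and updating bits, ranges of positions

!-++ˡ : ∀ xs ys {i} → i < length xs → (xs ++ ys) ! i ≡ xs ! i
!-++ˡ (x ∷ xs) ys {zero} _ = refl
!-++ˡ (x ∷ xs) ys {suc i} (s≤s i<) = !-++ˡ xs ys i<

!-++ʳ : ∀ xs ys p → (xs ++ ys) ! (length xs + p) ≡ ys ! p
!-++ʳ [] ys p = refl
!-++ʳ (x ∷ xs) ys p = !-++ʳ xs ys p

[]≔-++ˡ : ∀ xs ys {i} b → i < length xs → (xs ++ ys) [ i ]≔ b ≡ (xs [ i ]≔ b) ++ ys
[]≔-++ˡ (x ∷ xs) ys {zero} b _ = refl
[]≔-++ˡ (x ∷ xs) ys {suc i} b (s≤s i<) = cong (x ∷_) ([]≔-++ˡ xs ys b i<)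

[]≔-++ʳ : ∀ xs ys p b → (xs ++ ys) [ length xs + p ]≔ b ≡ xs ++ (ys [ p ]≔ b)
[]≔-++ʳ [] ys p b = refl
[]≔-++ʳ (x ∷ xs) ys p b = cong (x ∷_) ([]≔-++ʳ xs ys p b)

[]≔-middle : ∀ xs y ys b → (xs ++ y ∷ ys) [ length xs ]≔ b ≡ xs ++ b ∷ ys
[]≔-middle [] y ys b = refl
[]≔-middle (x ∷ xs) y ys b = cong (x ∷_) ([]≔-middle xs y ys b)

!-[]≔-≡ : ∀ w {i} b → i < length w → (w [ i ]≔ b) ! i ≡ b
!-[]≔-≡ (x ∷ w) {zero} b _ = refl
!-[]≔-≡ (x ∷ w) {suc i} b (s≤s i<) = !-[]≔-≡ w b i<

!-[]≔-≢ : ∀ w {i m} b → i ≢ m → (w [ i ]≔ b) ! m ≡ w ! m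
!-[]≔-≢ [] b _ = refl
!-[]≔-≢ (x ∷ w) {zero} {zero} b i≢m = ⊥-elim (i≢m refl)
!-[]≔-≢ (x ∷ w) {zero} {suc m} b _ = refl
!-[]≔-≢ (x ∷ w) {suc i} {zero} b _ = refl
!-[]≔-≢ (x ∷ w) {suc i} {suc m} b i≢m = !-[]≔-≢ w b (i≢m ∘ cong suc)

!-replicate : ∀ n m → replicate n false ! m ≡ false
!-replicate zero m = refl
!-replicate (suc n) zero = refl
!-replicate (suc n) (suc m) = !-replicate n m

!-true⇒< : ∀ w {m} → w ! m ≡ true → m < length w
!-true⇒< (x ∷ w) {zero} _ = s≤s z≤n
!-true⇒< (x ∷ w) {suc m} one = s≤s (!-true⇒< w one)

replicate-[]≔ : ∀ N {j} → j < N → replicate N false [ j ]≔ true ≡ replicate j false ++ true ∷ replicate (N ∸ suc j) false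
replicate-[]≔ (suc N) {zero} _ = refl
replicate-[]≔ (suc N) {suc j} (s≤s j<) = cong (false ∷_) (replicate-[]≔ N j<)

applyUpTo-+ : ∀ {A : Set} (f : ℕ → A) a b → applyUpTo f (a + b) ≡ applyUpTo f a ++ applyUpTo (f ∘ (a +_)) b
applyUpTo-+ f zero b = refl
applyUpTo-+ f (suc a) b = cong (f 0 ∷_) (applyUpTo-+ (f ∘ suc) a b)

upTo-+ : ∀ a b → upTo (a + b) ≡ upTo a ++ applyUpTo (a +_) b
upTo-+ = applyUpTo-+ id

applyUpTo-∸ : ∀ n → applyUpTo (n ∸_) (suc n) ≡ downFrom (suc n)
applyUpTo-∸ zero = refl
applyUpTo-∸ (suc n) = cong (suc n ∷_) (applyUpTo-∸ n)

concatMap-cong-∈ : ∀ {A B : Set} {f g : A → List B} xs → (∀ {x} → x ∈ xs → f x ≡ g x) → concatMap f xs ≡ concatMap g xs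
concatMap-cong-∈ [] eq = refl
concatMap-cong-∈ (x ∷ xs) eq = cong₂ _++_ (eq (here refl)) (concatMap-cong-∈ xs (eq ∘ there))

concatMap-[] : ∀ {A B : Set} {f : A → List B} xs → (∀ {x} → x ∈ xs → f x ≡ []) → concatMap f xs ≡ []
concatMap-[] [] _ = refl
concatMap-[] (x ∷ xs) none rewrite none (here refl) = concatMap-[] xs (none ∘ there)

concatMap-applyUpTo : ∀ {A : Set} (F : ℕ → List A) (f : ℕ → ℕ) n → concatMap F (applyUpTo f n) ≡ concatMap (F ∘ f) (upTo n)
concatMap-applyUpTo F f n = cong concat (trans (map-applyUpTo f F n) (sym (map-upTo (F ∘ f) n)))

filterᵇ-concatMap : ∀ {A B : Set} (p : B → Bool) (f : A → List B) xs →
  filterᵇ p (concatMap f xs) ≡ concatMap (filterᵇ p ∘ f) xs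
filterᵇ-concatMap p f [] = refl
filterᵇ-concatMap p f (x ∷ xs) = trans (filter-++ _ (f x) _) (cong (filterᵇ p (f x) ++_) (filterᵇ-concatMap p f xs))

filterᵇ-map : ∀ {A B : Set} (p : B → Bool) (q : A → Bool) (h : A → B) → (∀ a → p (h a) ≡ q a) →
  ∀ xs → filterᵇ p (map h xs) ≡ map h (filterᵇ q xs)
filterᵇ-map p q h eq [] = refl
filterᵇ-map p q h eq (x ∷ xs) rewrite eq x with q x
... | true = cong (h x ∷_) (filterᵇ-map p q h eq xs)
... | false = filterᵇ-map p q h eq xs

filterᵇ-[] : ∀ {A : Set} (p : A → Bool) xs → (∀ {y} → y ∈ xs → p y ≡ false) → filterᵇ p xs ≡ []
filterᵇ-[] p [] _ = refl
filterᵇ-[] p (x ∷ xs) none rewrite none (here refl) = filterᵇ-[] p xs (none ∘ there)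

any-++ : ∀ {A : Set} (p : A → Bool) xs ys → any p (xs ++ ys) ≡ any p xs ∨ any p ys
any-++ p [] ys = refl
any-++ p (x ∷ xs) ys = trans (cong (p x ∨_) (any-++ p xs ys)) (sym (Bool.∨-assoc (p x) _ _))

any-false : ∀ {A : Set} {p : A → Bool} xs → (∀ {m} → m ∈ xs → p m ≡ false) → any p xs ≡ false
any-false [] _ = refl
any-false (x ∷ xs) none rewrite none (here refl) = any-false xs (none ∘ there)

any-true : ∀ {A : Set} {p : A → Bool} {xs m} → m ∈ xs → p m ≡ true → any p xs ≡ true
any-true {p = p} {x ∷ xs} (here refl) pm rewrite pm = refl
any-true {p = p} {x ∷ xs} (there m∈) pm with p x
... | true = refl
... | false = any-true m∈ pm

any-cong : ∀ {A : Set} {p q : A → Bool} xs → (∀ {m} → m ∈ xs → p m ≡ q m) → any p xs ≡ any q xs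
any-cong [] _ = refl
any-cong (x ∷ xs) eq = cong₂ _∨_ (eq (here refl)) (any-cong xs (eq ∘ there))

any-applyUpTo : ∀ {A : Set} (p : A → Bool) (f : ℕ → A) n → any p (applyUpTo f n) ≡ any (p ∘ f) (upTo n)
any-applyUpTo p f n = cong or (trans (map-applyUpTo f p n) (sym (map-upTo (p ∘ f) n)))

<ᵇ-true : ∀ {m n} → m < n → (m <ᵇ n) ≡ true
<ᵇ-true m<n = Equivalence.to Bool.T-≡ (<⇒<ᵇ m<n)

<ᵇ-false : ∀ {m n} → n ≤ m → (m <ᵇ n) ≡ false
<ᵇ-false {m} {n} n≤m with m <ᵇ n in eq
... | false = refl
... | true = ⊥-elim (<⇒≱ (<ᵇ⇒< m n (Equivalence.from Bool.T-≡ eq)) n≤m)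

<ᵇ-+ : ∀ r a b → ((r + a) <ᵇ (r + b)) ≡ (a <ᵇ b)
<ᵇ-+ zero a b = refl
<ᵇ-+ (suc r) a b = <ᵇ-+ r a b

between⁺ : ∀ {i j m} → (i < m × m < j) ⊎ (j < m × m < i) → between i j m ≡ true
between⁺ (inj₁ (i<m , m<j)) rewrite <ᵇ-true i<m | <ᵇ-true m<j = refl
between⁺ {i} {j} {m} (inj₂ (j<m , m<i)) rewrite <ᵇ-true j<m | <ᵇ-true m<i =
  Bool.∨-zeroʳ ((i <ᵇ m) ∧ (m <ᵇ j))

between⁻ : ∀ i j m → between i j m ≡ true → (i < m × m < j) ⊎ (j < m × m < i)
between⁻ i j m eq = Sum.map ordered ordered (Equivalence.to Bool.T-∨ (Equivalence.from Bool.T-≡ eq))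
  where
  ordered : ∀ {a b c} → Data.Bool.T ((a <ᵇ b) ∧ (b <ᵇ c)) → a < b × b < c
  ordered {a} {b} {c} t = let (a<b , b<c) = Equivalence.to Bool.T-∧ t in <ᵇ⇒< a b a<b , <ᵇ⇒< b c b<c

between-false : ∀ {i j m} → (m ≤ i × m ≤ j) ⊎ (i ≤ m × j ≤ m) → between i j m ≡ false
between-false {i} {j} {m} outside with between i j m in eq
... | false = refl
... | true with between⁻ i j m eq | outside
... | inj₁ (i<m , _) | inj₁ (m≤i , _) = ⊥-elim (<⇒≱ i<m m≤i)
... | inj₁ (_ , m<j) | inj₂ (_ , j≤m) = ⊥-elim (<⇒≱ m<j j≤m)
... | inj₂ (j<m , _) | inj₁ (_ , m≤j) = ⊥-elim (<⇒≱ j<m m≤j)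
... | inj₂ (_ , m<i) | inj₂ (i≤m , _) = ⊥-elim (<⇒≱ m<i i≤m)

between-+ : ∀ r a b p → between (r + a) (r + b) (r + p) ≡ between a b p
between-+ r a b p rewrite <ᵇ-+ r a p | <ᵇ-+ r p b | <ᵇ-+ r b p | <ᵇ-+ r p a = refl

noOneBetween-true : ∀ w i j → (∀ m → between i j m ≡ true → w ! m ≡ false) → noOneBetweenᴸ w i j ≡ true
noOneBetween-true w i j zeros = cong not (any-false (upTo (length w)) λ {m} _ → test m)
  where
  test : ∀ m → between i j m ∧ w ! m ≡ false
  test m with between i j m in btw
  ... | false = refl
  ... | true = zeros m btw

noOneBetween-false : ∀ w i j m → between i j m ≡ true → w ! m ≡ true → noOneBetweenᴸ w i j ≡ false
noOneBetween-false w i j m btw one = cong not (any-true (∈-upTo⁺ (!-true⇒< w one)) (cong₂ _∧_ btw one))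

noOneBetween-++ˡ : ∀ q s {i j} → i < length q → j < length q → noOneBetweenᴸ (q ++ s) i j ≡ noOneBetweenᴸ q i j
noOneBetween-++ˡ q s {i} {j} i< j< = cong not (begin
  any P (upTo (length (q ++ s)))
    ≡⟨ cong (any P ∘ upTo) (length-++ q) ⟩
  any P (upTo (length q + length s))
    ≡⟨ cong (any P) (upTo-+ (length q) (length s)) ⟩
  any P (upTo (length q) ++ applyUpTo (length q +_) (length s))
    ≡⟨ any-++ P (upTo (length q)) _ ⟩
  any P (upTo (length q)) ∨ any P (applyUpTo (length q +_) (length s))
    ≡⟨ cong₂ _∨_ (any-cong (upTo (length q)) λ {m} m∈ → cong (between i j m ∧_) (!-++ˡ q s (∈-upTo⁻ m∈)))
                 (any-false _ λ {m} m∈ → cong (_∧ (q ++ s) ! m) (between-false (inj₂ (beyond m∈)))) ⟩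
  any Q (upTo (length q)) ∨ false
    ≡⟨ Bool.∨-identityʳ _ ⟩
  any Q (upTo (length q)) ∎)
  where
  open ≡-Reasoning
  P : ℕ → Bool
  P = λ m → between i j m ∧ (q ++ s) ! m
  Q : ℕ → Bool
  Q = λ m → between i j m ∧ q ! m
  beyond : ∀ {m} → m ∈ applyUpTo (length q +_) (length s) → i ≤ m × j ≤ m
  beyond m∈ with p , _ , refl ← ∈-applyUpTo⁻ (length q +_) m∈ =
    <⇒≤ (≤-trans i< (m≤m+n _ p)) , <⇒≤ (≤-trans j< (m≤m+n _ p))

noOneBetween-++ʳ : ∀ r t a b → noOneBetweenᴸ (r ++ t) (length r + a) (length r + b) ≡ noOneBetweenᴸ t a b
noOneBetween-++ʳ r t a b = cong not (begin
  any P (upTo (length (r ++ t)))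
    ≡⟨ cong (any P ∘ upTo) (length-++ r) ⟩
  any P (upTo (length r + length t))
    ≡⟨ cong (any P) (upTo-+ (length r) (length t)) ⟩
  any P (upTo (length r) ++ applyUpTo (length r +_) (length t))
    ≡⟨ any-++ P (upTo (length r)) _ ⟩
  any P (upTo (length r)) ∨ any P (applyUpTo (length r +_) (length t))
    ≡⟨ cong₂ _∨_ (any-false (upTo (length r)) λ {m} m∈ → cong (_∧ (r ++ t) ! m) (between-false (inj₁ (before (∈-upTo⁻ m∈)))))
                 (trans (any-applyUpTo P (length r +_) (length t))
                        (any-cong (upTo (length t)) λ {p} _ → cong₂ _∧_ (between-+ (length r) a b p) (!-++ʳ r t p))) ⟩
  false ∨ any Q (upTo (length t)) ∎)
  where
  open ≡-Reasoning
  P : ℕ → Bool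
  P = λ m → between (length r + a) (length r + b) m ∧ (r ++ t) ! m
  Q : ℕ → Bool
  Q = λ m → between a b m ∧ t ! m
  before : ∀ {m} → m < length r → m ≤ length r + a × m ≤ length r + b
  before m< = ≤-trans (<⇒≤ m<) (m≤m+n _ a) , ≤-trans (<⇒≤ m<) (m≤m+n _ b)

transposition-from-0 : ∀ w i j → w ! i ≡ false → transposition w i j ≡ []
transposition-from-0 w i j bit0 rewrite bit0 = refl

transposition-to-1 : ∀ w i j → w ! j ≡ true → transposition w i j ≡ []
transposition-to-1 w i j bit1 rewrite bit1 with w ! i
... | true = refl
... | false = refl

transposition-blocked : ∀ w i j → noOneBetweenᴸ w i j ≡ false → transposition w i j ≡ []
transposition-blocked w i j blocked rewrite blocked with w ! i | w ! j
... | true | true = refl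
... | true | false = refl
... | false | _ = refl

transposition-valid : ∀ w i j → w ! i ≡ true → w ! j ≡ false → noOneBetweenᴸ w i j ≡ true →
  transposition w i j ≡ (w [ i ]≔ false) [ j ]≔ true ∷ []
transposition-valid w i j bit1 bit0 free rewrite bit1 | bit0 | free = refl

transposition-++ˡ : ∀ q s {i j} → i < length q → j < length q →
  transposition (q ++ s) i j ≡ map (_++ s) (transposition q i j)
transposition-++ˡ q s {i} {j} i< j<
  rewrite !-++ˡ q s i< | !-++ˡ q s j< | noOneBetween-++ˡ q s i< j< | []≔-++ˡ q s false i<
        | []≔-++ˡ (q [ i ]≔ false) s true (subst (j <_) (sym (length-[]≔ q i false)) j<)
  = sym (Bool.if-float (map (_++ s)) (q ! i ∧ not (q ! j) ∧ noOneBetweenᴸ q i j))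

transposition-++ʳ : ∀ r t a b → transposition (r ++ t) (length r + a) (length r + b) ≡ map (r ++_) (transposition t a b)
transposition-++ʳ r t a b
  rewrite !-++ʳ r t a | !-++ʳ r t b | noOneBetween-++ʳ r t a b | []≔-++ʳ r t a false | []≔-++ʳ r (t [ a ]≔ false) b true
  = sym (Bool.if-float (map (r ++_)) (t ! a ∧ not (t ! b) ∧ noOneBetweenᴸ t a b))

-- Weights, adjacent 1s and levels

0ⁿ : ℕ → List Bool
0ⁿ n = replicate n false

weightᴸ-++ : ∀ xs ys → weightᴸ (xs ++ ys) ≡ weightᴸ xs + weightᴸ ys
weightᴸ-++ [] ys = refl
weightᴸ-++ (true ∷ xs) ys = cong suc (weightᴸ-++ xs ys)
weightᴸ-++ (false ∷ xs) ys = weightᴸ-++ xs ys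

weightᴸ-0ⁿ : ∀ n → weightᴸ (0ⁿ n) ≡ 0
weightᴸ-0ⁿ zero = refl
weightᴸ-0ⁿ (suc n) = weightᴸ-0ⁿ n

weightᴸ-++-0ⁿ : ∀ xs n → weightᴸ (xs ++ 0ⁿ n) ≡ weightᴸ xs
weightᴸ-++-0ⁿ xs n = trans (weightᴸ-++ xs (0ⁿ n)) (trans (cong (weightᴸ xs +_) (weightᴸ-0ⁿ n)) (+-identityʳ _))

weightᴸ-++-1∷0ⁿ : ∀ xs n → weightᴸ (xs ++ true ∷ 0ⁿ n) ≡ suc (weightᴸ xs)
weightᴸ-++-1∷0ⁿ xs n = trans (weightᴸ-++ xs (true ∷ 0ⁿ n)) (trans (cong (λ m → weightᴸ xs + suc m) (weightᴸ-0ⁿ n)) (+-comm (weightᴸ xs) 1))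

weightᴸ≤length : ∀ xs → weightᴸ xs ≤ length xs
weightᴸ≤length [] = z≤n
weightᴸ≤length (true ∷ xs) = s≤s (weightᴸ≤length xs)
weightᴸ≤length (false ∷ xs) = m≤n⇒m≤1+n (weightᴸ≤length xs)

weightᴸ≡0 : ∀ xs → weightᴸ xs ≡ 0 → xs ≡ 0ⁿ (length xs)
weightᴸ≡0 [] _ = refl
weightᴸ≡0 (false ∷ xs) w≡0 = cong (false ∷_) (weightᴸ≡0 xs w≡0)

noAdj-split : ∀ xs b ys → noAdj (xs ++ b ∷ ys) ≡ noAdj (xs ++ b ∷ []) ∧ noAdj (b ∷ ys)
noAdj-split [] true ys = refl
noAdj-split [] false ys = refl
noAdj-split (false ∷ xs) b ys = noAdj-split xs b ys
noAdj-split (true ∷ []) true ys = refl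
noAdj-split (true ∷ []) false ys = refl
noAdj-split (true ∷ true ∷ xs) b ys = refl
noAdj-split (true ∷ false ∷ xs) b ys = noAdj-split (false ∷ xs) b ys

noAdj-++-0 : ∀ xs → noAdj (xs ++ false ∷ []) ≡ noAdj xs
noAdj-++-0 [] = refl
noAdj-++-0 (false ∷ xs) = noAdj-++-0 xs
noAdj-++-0 (true ∷ []) = refl
noAdj-++-0 (true ∷ true ∷ xs) = refl
noAdj-++-0 (true ∷ false ∷ xs) = noAdj-++-0 (false ∷ xs)

noAdj-0ⁿ-++ : ∀ n ys → noAdj (0ⁿ n ++ ys) ≡ noAdj ys
noAdj-0ⁿ-++ zero ys = refl
noAdj-0ⁿ-++ (suc n) ys = noAdj-0ⁿ-++ n ys

noAdj-0ⁿ : ∀ n → noAdj (0ⁿ n) ≡ true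
noAdj-0ⁿ n = trans (cong noAdj (sym (++-identityʳ (0ⁿ n)))) (noAdj-0ⁿ-++ n [])

noAdj-1∷0ⁿ : ∀ n → noAdj (true ∷ 0ⁿ n) ≡ true
noAdj-1∷0ⁿ zero = refl
noAdj-1∷0ⁿ (suc n) = noAdj-0ⁿ n


noAdj-prefix : ∀ xs ys → noAdj (xs ++ ys) ≡ true → noAdj xs ≡ true
noAdj-prefix [] ys _ = refl
noAdj-prefix (false ∷ xs) ys ok = noAdj-prefix xs ys ok
noAdj-prefix (true ∷ []) ys _ = refl
noAdj-prefix (true ∷ false ∷ xs) ys ok = noAdj-prefix (false ∷ xs) ys ok

adjacent-ones : ∀ xs {m} → xs ! m ≡ true → xs ! suc m ≡ true → noAdj xs ≡ false
adjacent-ones (true ∷ true ∷ xs) {zero} _ _ = refl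
adjacent-ones (false ∷ xs) {suc m} one one′ = adjacent-ones xs one one′
adjacent-ones (true ∷ true ∷ xs) {suc m} _ _ = refl
adjacent-ones (true ∷ false ∷ xs) {suc m} one one′ = adjacent-ones (false ∷ xs) one one′

noAdj-weight : ∀ xs → noAdj xs ≡ true → weightᴸ xs + weightᴸ xs ≤ suc (length xs)
noAdj-weight [] _ = z≤n
noAdj-weight (false ∷ xs) ok = m≤n⇒m≤1+n (noAdj-weight xs ok)
noAdj-weight (true ∷ []) _ = s≤s (s≤s z≤n)
noAdj-weight (true ∷ false ∷ xs) ok =
  s≤s (≤-trans (≤-reflexive (+-suc (weightᴸ xs) (weightᴸ xs))) (s≤s (noAdj-weight xs ok)))

appendOne : ℕ → List Bool → List Bool
appendOne c q = q ++ false ∷ true ∷ 0ⁿ c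

inFᴸ-appendOne : ∀ k c q → inFᴸ (suc k) (appendOne c q) ≡ inFᴸ k q
inFᴸ-appendOne k c q
  rewrite weightᴸ-++ q (false ∷ true ∷ 0ⁿ c) | weightᴸ-0ⁿ c | +-comm (weightᴸ q) 1
        | noAdj-split q false (true ∷ 0ⁿ c) | noAdj-++-0 q | noAdj-1∷0ⁿ c | Bool.∧-identityʳ (noAdj q) = refl

appendOne-injective : ∀ c {x y} → appendOne c x ≡ appendOne c y → x ≡ y
appendOne-injective c {x} {y} = ++-cancelʳ (false ∷ true ∷ 0ⁿ c) x y

length-appendOne : ∀ c q → length (appendOne c q) ≡ length q + suc (suc c)
length-appendOne c q = trans (length-++ q) (cong (λ m → length q + suc (suc m)) (length-replicate c))

trailingZeros : List Bool → ℕ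
trailingZeros [] = 0
trailingZeros (b ∷ w) = if all not w then (if b then length w else suc (length w)) else trailingZeros w

all-not-0ⁿ : ∀ n → all not (0ⁿ n) ≡ true
all-not-0ⁿ zero = refl
all-not-0ⁿ (suc n) = all-not-0ⁿ n

all-not-1 : ∀ xs ys → all not (xs ++ true ∷ ys) ≡ false
all-not-1 [] ys = refl
all-not-1 (true ∷ xs) ys = refl
all-not-1 (false ∷ xs) ys = all-not-1 xs ys

trailingZeros-1∷0ⁿ : ∀ r d → trailingZeros (r ++ true ∷ 0ⁿ d) ≡ d
trailingZeros-1∷0ⁿ [] d rewrite all-not-0ⁿ d = length-replicate d
trailingZeros-1∷0ⁿ (x ∷ r) d rewrite all-not-1 r (0ⁿ d) = trailingZeros-1∷0ⁿ r d

trailingZeros-appendOne : ∀ c q → trailingZeros (appendOne c q) ≡ c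
trailingZeros-appendOne c q =
  trans (cong trailingZeros (sym (++-assoc q (false ∷ []) (true ∷ 0ⁿ c)))) (trailingZeros-1∷0ⁿ (q ++ false ∷ []) c)

noAdj-++-11 : ∀ r ys → noAdj (r ++ true ∷ true ∷ ys) ≡ false
noAdj-++-11 [] ys = refl
noAdj-++-11 (false ∷ r) ys = noAdj-++-11 r ys
noAdj-++-11 (true ∷ []) ys = refl
noAdj-++-11 (true ∷ true ∷ r) ys = refl
noAdj-++-11 (true ∷ false ∷ r) ys = noAdj-++-11 (false ∷ r) ys

0ⁿ-++-0ⁿ : ∀ a b → 0ⁿ a ++ 0ⁿ b ≡ 0ⁿ (a + b)
0ⁿ-++-0ⁿ zero b = refl
0ⁿ-++-0ⁿ (suc a) b = cong (false ∷_) (0ⁿ-++-0ⁿ a b)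

noAdj-tail : ∀ x xs → noAdj (x ∷ xs) ≡ true → noAdj xs ≡ true
noAdj-tail false xs ok = ok
noAdj-tail true [] ok = refl
noAdj-tail true (false ∷ xs) ok = ok

noAdj-one-before-one : ∀ w {i j} → j < length w → i ≢ suc j → w ! suc j ≡ true → noAdj ((w [ i ]≔ false) [ j ]≔ true) ≡ false
noAdj-one-before-one w {i} {j} j<w i≢ bit1 = adjacent-ones ((w [ i ]≔ false) [ j ]≔ true)
  (!-[]≔-≡ (w [ i ]≔ false) true (subst (j <_) (sym (length-[]≔ w i false)) j<w))
  (trans (!-[]≔-≢ (w [ i ]≔ false) true (λ eq → 1+n≢n (sym eq))) (trans (!-[]≔-≢ w false i≢) bit1))

0ⁿ-++ : ∀ u ys → 0ⁿ u ++ false ∷ ys ≡ false ∷ 0ⁿ u ++ ys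
0ⁿ-++ zero ys = refl
0ⁿ-++ (suc u) ys = cong (false ∷_) (0ⁿ-++ u ys)

-- The candidate lists of appendOne c q and of words with a single 1

descendingExcept : (ℕ → List Bool) → ℕ → ℕ → List (List Bool)
descendingExcept f c n = concatMap (λ b → if b ≡ᵇ c then [] else f b ∷ []) (downFrom (suc n))

≡ᵇ-refl : ∀ m → (m ≡ᵇ m) ≡ true
≡ᵇ-refl m = Equivalence.to Bool.T-≡ (≡⇒≡ᵇ m m refl)

≡ᵇ-≢ : ∀ {m n} → m ≢ n → (m ≡ᵇ n) ≡ false
≡ᵇ-≢ {m} {n} m≢n with m ≡ᵇ n in eq
... | false = refl
... | true = ⊥-elim (m≢n (≡ᵇ⇒≡ m n (Equivalence.from Bool.T-≡ eq)))

descendingExcept-skip : ∀ f n → descendingExcept f (suc n) (suc n) ≡ descendingExcept f (suc n) n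
descendingExcept-skip f n =
  cong (λ x → (if x then [] else f (suc n) ∷ []) ++ descendingExcept f (suc n) n) (≡ᵇ-refl n)

descendingExcept-keep₀ : ∀ f {c} → 0 ≢ c → descendingExcept f c 0 ≡ f 0 ∷ []
descendingExcept-keep₀ f 0≢c = cong (λ x → (if x then [] else f 0 ∷ []) ++ []) (≡ᵇ-≢ 0≢c)

descendingExcept-keep : ∀ f {c} n → suc n ≢ c → descendingExcept f c (suc n) ≡ f (suc n) ∷ descendingExcept f c n
descendingExcept-keep f {c} n n≢c =
  cong (λ x → (if x then [] else f (suc n) ∷ []) ++ descendingExcept f c n) (≡ᵇ-≢ n≢c)

concatMap-upTo-+ : ∀ {A : Set} (F : ℕ → List A) a b →
  concatMap F (upTo (a + b)) ≡ concatMap F (upTo a) ++ concatMap (F ∘ (a +_)) (upTo b)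
concatMap-upTo-+ F a b = begin
  concatMap F (upTo (a + b))                                  ≡⟨ cong (concatMap F) (upTo-+ a b) ⟩
  concatMap F (upTo a ++ applyUpTo (a +_) b)                  ≡⟨ concatMap-++ F (upTo a) _ ⟩
  concatMap F (upTo a) ++ concatMap F (applyUpTo (a +_) b)    ≡⟨ cong (concatMap F (upTo a) ++_) (concatMap-applyUpTo F (a +_) b) ⟩
  concatMap F (upTo a) ++ concatMap (F ∘ (a +_)) (upTo b)     ∎
  where open ≡-Reasoning

concatMap-levels : ∀ (f : ℕ → List Bool) c n {F : ℕ → List (List Bool)} →
  (∀ {u} → u ≤ n → F u ≡ (if (n ∸ u) ≡ᵇ c then [] else f (n ∸ u) ∷ [])) →
  concatMap F (upTo (suc n)) ≡ descendingExcept f c n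
concatMap-levels f c n {F} F≗ = begin
  concatMap F (upTo (suc n))                  ≡⟨ concatMap-cong-∈ (upTo (suc n)) (λ u∈ → F≗ (≤-pred (∈-upTo⁻ u∈))) ⟩
  concatMap (atLevel ∘ (n ∸_)) (upTo (suc n)) ≡⟨ concatMap-applyUpTo atLevel (n ∸_) (suc n) ⟨
  concatMap atLevel (applyUpTo (n ∸_) (suc n)) ≡⟨ cong (concatMap atLevel) (applyUpTo-∸ n) ⟩
  descendingExcept f c n                      ∎
  where
  open ≡-Reasoning
  atLevel = λ b → if b ≡ᵇ c then [] else f b ∷ []

transpositionsFrom-0 : ∀ w {i} → w ! i ≡ false → transpositionsFrom w i ≡ []
transpositionsFrom-0 w bit0 = concatMap-[] (upTo (length w)) λ {j} _ → transposition-from-0 w _ j bit0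

filterᵇ-singleton : ∀ {A : Set} (p : A → Bool) {x} → p x ≡ true → filterᵇ p (x ∷ []) ≡ x ∷ []
filterᵇ-singleton p px rewrite px = refl

inFᴸ-adjacent : ∀ k {y} → noAdj y ≡ false → inFᴸ k y ≡ false
inFᴸ-adjacent k {y} adjacent = trans (cong (does (weightᴸ y Data.Nat.≟ k) ∧_) adjacent) (Bool.∧-zeroʳ _)

module InnerMoves (k c : ℕ) (q : List Bool) {i : ℕ} (i<q : i < length q) where

  w : List Bool
  w = appendOne c q
  s : List Bool
  s = false ∷ true ∷ 0ⁿ c
  P : List Bool → Bool
  P = inFᴸ (suc k)

  moves-inside : filterᵇ P (concatMap (transposition w i) (upTo (length q)))
                 ≡ map (appendOne c) (filterᵇ (inFᴸ k) (transpositionsFrom q i))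
  moves-inside = begin
    filterᵇ P (concatMap (transposition w i) (upTo (length q)))
      ≡⟨ filterᵇ-concatMap P (transposition w i) (upTo (length q)) ⟩
    concatMap (filterᵇ P ∘ transposition w i) (upTo (length q))
      ≡⟨ concatMap-cong-∈ _ (λ j∈ → trans (cong (filterᵇ P) (transposition-++ˡ q s i<q (∈-upTo⁻ j∈)))
                                          (filterᵇ-map P (inFᴸ k) (appendOne c) (inFᴸ-appendOne k c) (transposition q i _))) ⟩
    concatMap (map (appendOne c) ∘ filterᵇ (inFᴸ k) ∘ transposition q i) (upTo (length q))
      ≡⟨ map-concatMap (appendOne c) (filterᵇ (inFᴸ k) ∘ transposition q i) (upTo (length q)) ⟨
    map (appendOne c) (concatMap (filterᵇ (inFᴸ k) ∘ transposition q i) (upTo (length q)))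
      ≡⟨ cong (map (appendOne c)) (filterᵇ-concatMap (inFᴸ k) (transposition q i) (upTo (length q))) ⟨
    map (appendOne c) (filterᵇ (inFᴸ k) (transpositionsFrom q i)) ∎
    where open ≡-Reasoning

  -- Moving the 1 to position |q| makes it adjacent to the last 1; further right, that 1 is in the way.
  no-moves-outside : ∀ {y} → y ∈ concatMap (transposition w i ∘ (length q +_)) (upTo (suc (suc c))) → P y ≡ false
  no-moves-outside y∈ with find (∈-concatMap⁻ (transposition w i ∘ (length q +_)) {xs = upTo (suc (suc c))} y∈)
  ... | 0 , _ , y∈T rewrite ∈-transposition w i _ y∈T = inFᴸ-adjacent (suc k) {(w [ i ]≔ false) [ length q + 0 ]≔ true} (noAdj-one-before-one w
    (subst (length q + 0 <_) (sym (length-appendOne c q)) (+-monoʳ-< (length q) (s≤s z≤n)))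
    (λ eq → <-irrefl eq (≤-trans i<q (≤-trans (m≤m+n _ 0) (n≤1+n _))))
    (trans (cong (w !_) (sym (+-suc (length q) 0))) (!-++ʳ q s 1)))
  ... | 1 , _ , y∈T = case subst (_ ∈_) (transposition-to-1 w i (length q + 1) (!-++ʳ q s 1)) y∈T of λ ()
  ... | suc (suc u) , _ , y∈T = case subst (_ ∈_) (transposition-blocked w i _ blocked) y∈T of λ ()
    where
    blocked : noOneBetweenᴸ w i (length q + suc (suc u)) ≡ false
    blocked = noOneBetween-false w i (length q + suc (suc u)) (length q + 1)
      (between⁺ (inj₁ (≤-trans i<q (m≤m+n _ 1) , +-monoʳ-< (length q) (s≤s (s≤s z≤n))))) (!-++ʳ q s 1)

  moves : filterᵇ P (transpositionsFrom w i) ≡ map (appendOne c) (filterᵇ (inFᴸ k) (transpositionsFrom q i))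
  moves = begin
    filterᵇ P (concatMap (transposition w i) (upTo (length w)))
      ≡⟨ cong (λ n → filterᵇ P (concatMap (transposition w i) (upTo n))) (length-appendOne c q) ⟩
    filterᵇ P (concatMap (transposition w i) (upTo (length q + suc (suc c))))
      ≡⟨ cong (filterᵇ P) (concatMap-upTo-+ (transposition w i) (length q) (suc (suc c))) ⟩
    filterᵇ P (concatMap (transposition w i) (upTo (length q)) ++ outside)
      ≡⟨ filter-++ _ (concatMap (transposition w i) (upTo (length q))) outside ⟩
    filterᵇ P (concatMap (transposition w i) (upTo (length q))) ++ filterᵇ P outside
      ≡⟨ cong₂ _++_ moves-inside (filterᵇ-[] P outside no-moves-outside) ⟩
    map (appendOne c) (filterᵇ (inFᴸ k) (transpositionsFrom q i)) ++ []
      ≡⟨ ++-identityʳ _ ⟩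
    map (appendOne c) (filterᵇ (inFᴸ k) (transpositionsFrom q i)) ∎
    where
    open ≡-Reasoning
    outside : List (List Bool)
    outside = concatMap (transposition w i ∘ (length q +_)) (upTo (suc (suc c)))

record LastOne (K : ℕ) (q : List Bool) : Set where
  field
    prefix : List Bool
    zeros : ℕ
    split : q ≡ prefix ++ true ∷ 0ⁿ zeros
    weight-prefix : weightᴸ prefix ≡ K
    noAdj-prefix1 : noAdj (prefix ++ true ∷ []) ≡ true

lastOneMoves : ∀ {K q} → LastOne K q → ℕ → List (List Bool)
lastOneMoves D c = descendingExcept (λ b → appendOne b (prefix ++ true ∷ 0ⁿ (zeros + c ∸ b))) c (zeros + c)
  where open LastOne D

lastBlock : ℕ → ℕ → List Bool
lastBlock d c = true ∷ 0ⁿ d ++ false ∷ true ∷ 0ⁿ c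

lastBlock-ones : ∀ d c {m} → lastBlock d c ! m ≡ true → m ≡ 0 ⊎ m ≡ suc (suc d)
lastBlock-ones d c {zero} _ = inj₁ refl
lastBlock-ones d c {suc m} bit1 = inj₂ (cong suc (tail d bit1))
  where
  tail : ∀ d {m} → (0ⁿ d ++ false ∷ true ∷ 0ⁿ c) ! m ≡ true → m ≡ suc d
  tail zero {suc zero} _ = refl
  tail zero {suc (suc m)} bit1 = case trans (sym (!-replicate c m)) bit1 of λ ()
  tail (suc d) {suc m} bit1 = cong suc (tail d bit1)

lastBlock-last : ∀ d c → lastBlock d c ! suc (suc d) ≡ true
lastBlock-last zero c = refl
lastBlock-last (suc d) c = lastBlock-last d c

lastBlock-free : ∀ d c {u} → u ≢ d → lastBlock d c ! suc (suc u) ≡ false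
lastBlock-free d c {u} u≢d with lastBlock d c ! suc (suc u) in bit
... | false = refl
... | true with lastBlock-ones d c {suc (suc u)} bit
...   | inj₂ eq = ⊥-elim (u≢d (suc-injective (suc-injective eq)))

lastBlock-between : ∀ d c {u} m → between (suc (suc d)) (suc (suc u)) m ≡ true → lastBlock d c ! m ≡ false
lastBlock-between d c m btw with lastBlock d c ! m in bit
... | false = refl
... | true with lastBlock-ones d c {m} bit | between⁻ _ _ m btw
...   | inj₁ refl | inj₁ (() , _)
...   | inj₁ refl | inj₂ (() , _)
...   | inj₂ refl | inj₁ (lt , _) = ⊥-elim (<-irrefl refl lt)
...   | inj₂ refl | inj₂ (_ , lt) = ⊥-elim (<-irrefl refl lt)

length-lastBlock : ∀ d c → length (lastBlock d c) ≡ suc (suc (suc (d + c)))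
length-lastBlock d c = cong suc (begin
  length (0ⁿ d ++ false ∷ true ∷ 0ⁿ c)        ≡⟨ length-++ (0ⁿ d) ⟩
  length (0ⁿ d) + suc (suc (length (0ⁿ c)))  ≡⟨ cong₂ (λ x y → x + suc (suc y)) (length-replicate d) (length-replicate c) ⟩
  d + suc (suc c)                            ≡⟨ +-suc d (suc c) ⟩
  suc (d + suc c)                            ≡⟨ cong suc (+-suc d c) ⟩
  suc (suc (d + c))                          ∎)
  where open ≡-Reasoning

lastBlock-cleared : ∀ d c → lastBlock d c [ suc (suc d) ]≔ false ≡ true ∷ 0ⁿ (suc (suc (d + c)))
lastBlock-cleared d c = cong (true ∷_) (clear d)
  where
  clear : ∀ d → (0ⁿ d ++ false ∷ true ∷ 0ⁿ c) [ suc d ]≔ false ≡ 0ⁿ (suc (suc (d + c)))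
  clear zero = refl
  clear (suc d) = cong (false ∷_) (clear d)

lastBlock-moved : ∀ d c {u} → u ≤ d + c →
  (lastBlock d c [ suc (suc d) ]≔ false) [ suc (suc u) ]≔ true ≡ true ∷ 0ⁿ (suc u) ++ true ∷ 0ⁿ (d + c ∸ u)
lastBlock-moved d c {u} u≤n = trans (cong (_[ suc (suc u) ]≔ true) (lastBlock-cleared d c))
                                (cong (true ∷_) (replicate-[]≔ (suc (suc (d + c))) (s≤s (s≤s u≤n))))

module AppendOneCandidates (K : ℕ) (r : List Bool) (d c : ℕ)
                           (weight-r : weightᴸ r ≡ K) (noAdj-r1 : noAdj (r ++ true ∷ []) ≡ true) where

  n : ℕ
  n = d + c
  q : List Bool
  q = r ++ true ∷ 0ⁿ d
  w : List Bool
  w = appendOne c q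
  t : List Bool
  t = lastBlock d c
  P : List Bool → Bool
  P = inFᴸ (suc (suc K))
  target : ℕ → List Bool
  target b = appendOne b (r ++ true ∷ 0ⁿ (n ∸ b))
  cell : ℕ → List (List Bool)
  cell p = filterᵇ P (map (r ++_) (transposition t (suc (suc d)) p))

  moved∈F : ∀ u → P (r ++ true ∷ 0ⁿ (suc u) ++ true ∷ 0ⁿ (n ∸ u)) ≡ true
  moved∈F u rewrite weightᴸ-++ r (true ∷ 0ⁿ (suc u) ++ true ∷ 0ⁿ (n ∸ u)) | weightᴸ-++ (0ⁿ (suc u)) (true ∷ 0ⁿ (n ∸ u))
                  | weightᴸ-0ⁿ u | weightᴸ-0ⁿ (n ∸ u) | weight-r | +-comm K 2 | ≡ᵇ-refl K
                  | noAdj-split r true (0ⁿ (suc u) ++ true ∷ 0ⁿ (n ∸ u)) | noAdj-r1 | noAdj-0ⁿ-++ u (true ∷ 0ⁿ (n ∸ u))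
    = noAdj-1∷0ⁿ (n ∸ u)

  moved≡target : ∀ {u} → u ≤ n → r ++ true ∷ 0ⁿ (suc u) ++ true ∷ 0ⁿ (n ∸ u) ≡ target (n ∸ u)
  moved≡target {u} u≤n rewrite m∸[m∸n]≡n u≤n = begin
    r ++ true ∷ 0ⁿ (suc u) ++ true ∷ 0ⁿ (n ∸ u)    ≡⟨ cong (λ z → r ++ true ∷ z) (0ⁿ-++ u (true ∷ 0ⁿ (n ∸ u))) ⟨
    r ++ true ∷ 0ⁿ u ++ false ∷ true ∷ 0ⁿ (n ∸ u)  ≡⟨ ++-assoc r (true ∷ 0ⁿ u) (false ∷ true ∷ 0ⁿ (n ∸ u)) ⟨
    appendOne (n ∸ u) (r ++ true ∷ 0ⁿ u)           ∎
    where open ≡-Reasoning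

  move : ∀ {u} → u ≤ n → cell (suc (suc u)) ≡ (if (n ∸ u) ≡ᵇ c then [] else target (n ∸ u) ∷ [])
  move {u} u≤n with u ≟ d
  ... | yes refl = begin
    cell (suc (suc d))
      ≡⟨ cong (filterᵇ P ∘ map (r ++_)) (transposition-to-1 t (suc (suc d)) (suc (suc d)) (lastBlock-last d c)) ⟩
    []
      ≡⟨ cong (λ x → if x then [] else target (n ∸ d) ∷ []) (trans (cong (_≡ᵇ c) (m+n∸m≡n d c)) (≡ᵇ-refl c)) ⟨
    (if (n ∸ d) ≡ᵇ c then [] else target (n ∸ d) ∷ []) ∎
    where open ≡-Reasoning
  ... | no u≢d = begin
    cell (suc (suc u))
      ≡⟨ cong (filterᵇ P ∘ map (r ++_)) (transposition-valid t (suc (suc d)) (suc (suc u)) (lastBlock-last d c)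
                (lastBlock-free d c u≢d) (noOneBetween-true t _ _ (lastBlock-between d c))) ⟩
    filterᵇ P ((r ++ ((t [ suc (suc d) ]≔ false) [ suc (suc u) ]≔ true)) ∷ [])
      ≡⟨ cong (λ z → filterᵇ P ((r ++ z) ∷ [])) (lastBlock-moved d c u≤n) ⟩
    filterᵇ P ((r ++ true ∷ 0ⁿ (suc u) ++ true ∷ 0ⁿ (n ∸ u)) ∷ [])
      ≡⟨ filterᵇ-singleton P (moved∈F u) ⟩
    (r ++ true ∷ 0ⁿ (suc u) ++ true ∷ 0ⁿ (n ∸ u)) ∷ []
      ≡⟨ cong (_∷ []) (moved≡target u≤n) ⟩
    target (n ∸ u) ∷ []
      ≡⟨ cong (λ x → if x then [] else target (n ∸ u) ∷ []) (≡ᵇ-≢ n∸u≢c) ⟨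
    (if (n ∸ u) ≡ᵇ c then [] else target (n ∸ u) ∷ []) ∎
    where
    open ≡-Reasoning
    n∸u≢c : n ∸ u ≢ c
    n∸u≢c eq = u≢d (+-cancelʳ-≡ c u d (trans (cong (u +_) (sym eq)) (trans (+-comm u (n ∸ u)) (m∸n+n≡m u≤n))))

  -- the last 1 would become adjacent to the previous one
  cell1 : cell 1 ≡ []
  cell1 = filterᵇ-[] P _ λ y∈ → adjacent y∈
    where
    adjacent : ∀ {y} → y ∈ map (r ++_) (transposition t (suc (suc d)) 1) → P y ≡ false
    adjacent y∈ with z , z∈ , refl ← ∈-map⁻ (r ++_) y∈ = trans
      (cong (P ∘ (r ++_)) (trans (∈-transposition t (suc (suc d)) 1 z∈) (cong (_[ 1 ]≔ true) (lastBlock-cleared d c))))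
      (inFᴸ-adjacent (suc (suc K)) {r ++ true ∷ true ∷ 0ⁿ (suc n)} (noAdj-++-11 r (0ⁿ (suc n))))

  moves-of-block : concatMap cell (upTo (length t)) ≡ descendingExcept target c n
  moves-of-block = begin
    concatMap cell (upTo (length t))
      ≡⟨ cong (concatMap cell ∘ upTo) (length-lastBlock d c) ⟩
    cell 0 ++ cell 1 ++ concatMap cell (applyUpTo (2 +_) (suc n))
      ≡⟨ cong₂ (λ x y → x ++ y ++ concatMap cell (applyUpTo (2 +_) (suc n))) cell0 cell1 ⟩
    concatMap cell (applyUpTo (2 +_) (suc n))
      ≡⟨ concatMap-applyUpTo cell (2 +_) (suc n) ⟩
    concatMap (cell ∘ (2 +_)) (upTo (suc n))
      ≡⟨ concatMap-levels target c n move ⟩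
    descendingExcept target c n ∎
    where
    open ≡-Reasoning
    cell0 : cell 0 ≡ []
    cell0 = cong (filterᵇ P ∘ map (r ++_)) (transposition-to-1 t (suc (suc d)) 0 refl)

  blocked-by-previous : ∀ {j} → j < length r → transposition (r ++ t) (length r + suc (suc d)) j ≡ []
  blocked-by-previous {j} j<r = transposition-blocked (r ++ t) _ j
    (noOneBetween-false (r ++ t) _ j (length r) (between⁺ (inj₂ (j<r , m<m+n (length r) (s≤s z≤n))))
      (trans (cong ((r ++ t) !_) (sym (+-identityʳ (length r)))) (!-++ʳ r t 0)))

  moves-of-last-one : filterᵇ P (transpositionsFrom w (length r + suc (suc d))) ≡ descendingExcept target c n
  moves-of-last-one = begin
    filterᵇ P (concatMap (moveLast w) (upTo (length w)))
      ≡⟨ cong (λ z → filterᵇ P (concatMap (moveLast z) (upTo (length z)))) (++-assoc r (true ∷ 0ⁿ d) (false ∷ true ∷ 0ⁿ c)) ⟩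
    filterᵇ P (concatMap (moveLast (r ++ t)) (upTo (length (r ++ t))))
      ≡⟨ cong (filterᵇ P ∘ concatMap (moveLast (r ++ t)) ∘ upTo) (length-++ r) ⟩
    filterᵇ P (concatMap (moveLast (r ++ t)) (upTo (length r + length t)))
      ≡⟨ cong (filterᵇ P) (concatMap-upTo-+ (moveLast (r ++ t)) (length r) (length t)) ⟩
    filterᵇ P (concatMap (moveLast (r ++ t)) (upTo (length r)) ++ concatMap (moveLast (r ++ t) ∘ (length r +_)) (upTo (length t)))
      ≡⟨ cong (λ z → filterᵇ P (z ++ concatMap (moveLast (r ++ t) ∘ (length r +_)) (upTo (length t))))
              (concatMap-[] (upTo (length r)) (blocked-by-previous ∘ ∈-upTo⁻)) ⟩
    filterᵇ P (concatMap (moveLast (r ++ t) ∘ (length r +_)) (upTo (length t)))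
      ≡⟨ cong (filterᵇ P) (concatMap-cong-∈ (upTo (length t)) λ {p} _ → transposition-++ʳ r t (suc (suc d)) p) ⟩
    filterᵇ P (concatMap (map (r ++_) ∘ transposition t (suc (suc d))) (upTo (length t)))
      ≡⟨ filterᵇ-concatMap P (map (r ++_) ∘ transposition t (suc (suc d))) (upTo (length t)) ⟩
    concatMap cell (upTo (length t))
      ≡⟨ moves-of-block ⟩
    descendingExcept target c n ∎
    where
    open ≡-Reasoning
    moveLast : List Bool → ℕ → List (List Bool)
    moveLast z = transposition z (length r + suc (suc d))

  R : ℕ → List (List Bool)
  R = filterᵇ P ∘ transpositionsFrom w

  zero-row : ∀ p → (false ∷ true ∷ 0ⁿ c) ! p ≡ false → R (length q + p) ≡ []
  zero-row p bit0 = cong (filterᵇ P) (transpositionsFrom-0 w (trans (!-++ʳ q (false ∷ true ∷ 0ⁿ c) p) bit0))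

  last-position : length q + 1 ≡ length r + suc (suc d)
  last-position = begin
    length q + 1                          ≡⟨ +-comm (length q) 1 ⟩
    suc (length q)                        ≡⟨ cong suc (length-++ r) ⟩
    suc (length r + suc (length (0ⁿ d)))  ≡⟨ +-suc (length r) _ ⟨
    length r + suc (suc (length (0ⁿ d)))  ≡⟨ cong (λ x → length r + suc (suc x)) (length-replicate d) ⟩
    length r + suc (suc d)                ∎
    where open ≡-Reasoning

  moves-after-q : concatMap (R ∘ (length q +_)) (upTo (suc (suc c))) ≡ descendingExcept target c n
  moves-after-q = begin
    R (length q + 0) ++ R (length q + 1) ++ concatMap (R ∘ (length q +_)) (applyUpTo (2 +_) c)
      ≡⟨ cong₂ (λ x z → x ++ R (length q + 1) ++ z) (zero-row 0 refl) (concatMap-[] (applyUpTo (2 +_) c) beyond-last-one) ⟩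
    R (length q + 1) ++ []      ≡⟨ ++-identityʳ _ ⟩
    R (length q + 1)            ≡⟨ cong R last-position ⟩
    R (length r + suc (suc d))  ≡⟨ moves-of-last-one ⟩
    descendingExcept target c n ∎
    where
    open ≡-Reasoning
    beyond-last-one : ∀ {x} → x ∈ applyUpTo (2 +_) c → R (length q + x) ≡ []
    beyond-last-one x∈ with u , _ , refl ← ∈-applyUpTo⁻ (2 +_) x∈ = zero-row (2 + u) (!-replicate c u)

  moves-inside-q : concatMap R (upTo (length q)) ≡ map (appendOne c) (candidates (suc K) q)
  moves-inside-q = begin
    concatMap R (upTo (length q))
      ≡⟨ concatMap-cong-∈ (upTo (length q)) (λ i∈ → InnerMoves.moves (suc K) c q (∈-upTo⁻ i∈)) ⟩
    concatMap (map (appendOne c) ∘ filterᵇ (inFᴸ (suc K)) ∘ transpositionsFrom q) (upTo (length q))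
      ≡⟨ map-concatMap (appendOne c) (filterᵇ (inFᴸ (suc K)) ∘ transpositionsFrom q) (upTo (length q)) ⟨
    map (appendOne c) (concatMap (filterᵇ (inFᴸ (suc K)) ∘ transpositionsFrom q) (upTo (length q)))
      ≡⟨ cong (map (appendOne c)) (filterᵇ-concatMap (inFᴸ (suc K)) (transpositionsFrom q) (upTo (length q))) ⟨
    map (appendOne c) (candidates (suc K) q) ∎
    where open ≡-Reasoning

  candidates-w : candidates (suc (suc K)) w ≡ map (appendOne c) (candidates (suc K) q) ++ descendingExcept target c n
  candidates-w = begin
    filterᵇ P (concatMap (transpositionsFrom w) (upTo (length w)))
      ≡⟨ filterᵇ-concatMap P (transpositionsFrom w) (upTo (length w)) ⟩
    concatMap R (upTo (length w))
      ≡⟨ cong (concatMap R ∘ upTo) (length-appendOne c q) ⟩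
    concatMap R (upTo (length q + suc (suc c)))
      ≡⟨ concatMap-upTo-+ R (length q) (suc (suc c)) ⟩
    concatMap R (upTo (length q)) ++ concatMap (R ∘ (length q +_)) (upTo (suc (suc c)))
      ≡⟨ cong₂ _++_ moves-inside-q moves-after-q ⟩
    map (appendOne c) (candidates (suc K) q) ++ descendingExcept target c n ∎
    where open ≡-Reasoning

candidates-appendOne : ∀ {K q} (D : LastOne K q) c →
  candidates (suc (suc K)) (appendOne c q) ≡ map (appendOne c) (candidates (suc K) q) ++ lastOneMoves D c
candidates-appendOne {K} record { prefix = r ; zeros = d ; split = refl ; weight-prefix = weight-r ; noAdj-prefix1 = noAdj-r1 } c =
  AppendOneCandidates.candidates-w K r d c weight-r noAdj-r1

singleOne : ℕ → ℕ → List Bool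
singleOne M l = 0ⁿ (M ∸ l) ++ true ∷ 0ⁿ l

module SingleOneCandidates {M c : ℕ} (c≤M : c ≤ M) where

  a : ℕ
  a = M ∸ c
  w : List Bool
  w = singleOne M c
  P : List Bool → Bool
  P = inFᴸ 1
  R : ℕ → List (List Bool)
  R = filterᵇ P ∘ transpositionsFrom w
  atLevel : ℕ → List (List Bool)
  atLevel b = if b ≡ᵇ c then [] else singleOne M b ∷ []

  a+c : a + suc c ≡ suc M
  a+c = trans (+-suc a c) (cong suc (m∸n+n≡m c≤M))

  length-w : length w ≡ a + suc c
  length-w = trans (length-++ (0ⁿ a)) (cong₂ _+_ (length-replicate a) (cong suc (length-replicate c)))

  w!a+ : ∀ p → w ! (a + p) ≡ (true ∷ 0ⁿ c) ! p
  w!a+ p = trans (cong (λ x → w ! (x + p)) (sym (length-replicate a))) (!-++ʳ (0ⁿ a) (true ∷ 0ⁿ c) p)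

  w!a : w ! a ≡ true
  w!a = trans (cong (w !_) (sym (+-identityʳ a))) (w!a+ 0)

  w!<a : ∀ {i} → i < a → w ! i ≡ false
  w!<a {i} i<a = trans (!-++ˡ (0ⁿ a) (true ∷ 0ⁿ c) (subst (i <_) (sym (length-replicate a)) i<a)) (!-replicate a i)

  only-one : ∀ {m} → w ! m ≡ true → m ≡ a
  only-one {m} bit1 with m <? a
  ... | yes m<a = case trans (sym bit1) (w!<a m<a) of λ ()
  ... | no m≮a with p , refl ← m≤n⇒∃[o]m+o≡n (≮⇒≥ m≮a) with p
  ...   | zero = +-identityʳ a
  ...   | suc p′ = case trans (sym bit1) (trans (w!a+ (suc p′)) (!-replicate c p′)) of λ ()

  cleared : w [ a ]≔ false ≡ 0ⁿ (suc M)
  cleared = begin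
    w [ a ]≔ false               ≡⟨ cong (w [_]≔ false) (sym (length-replicate a)) ⟩
    w [ length (0ⁿ a) ]≔ false   ≡⟨ []≔-middle (0ⁿ a) true (0ⁿ c) false ⟩
    0ⁿ a ++ 0ⁿ (suc c)           ≡⟨ 0ⁿ-++-0ⁿ a (suc c) ⟩
    0ⁿ (a + suc c)               ≡⟨ cong 0ⁿ a+c ⟩
    0ⁿ (suc M)                   ∎
    where open ≡-Reasoning

  moved∈F : ∀ j → P (0ⁿ j ++ true ∷ 0ⁿ (M ∸ j)) ≡ true
  moved∈F j rewrite weightᴸ-++ (0ⁿ j) (true ∷ 0ⁿ (M ∸ j)) | weightᴸ-0ⁿ j | weightᴸ-0ⁿ (M ∸ j)
                  | noAdj-0ⁿ-++ j (true ∷ 0ⁿ (M ∸ j)) = noAdj-1∷0ⁿ (M ∸ j)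

  move : ∀ {j} → j ≤ M → filterᵇ P (transposition w a j) ≡ atLevel (M ∸ j)
  move {j} j≤M with j ≟ a
  ... | yes refl = begin
    filterᵇ P (transposition w a a)
      ≡⟨ cong (filterᵇ P) (transposition-to-1 w a a w!a) ⟩
    []
      ≡⟨ cong (λ x → if x then [] else singleOne M (M ∸ a) ∷ []) (trans (cong (_≡ᵇ c) (m∸[m∸n]≡n c≤M)) (≡ᵇ-refl c)) ⟨
    atLevel (M ∸ a) ∎
    where open ≡-Reasoning
  ... | no j≢a = begin
    filterᵇ P (transposition w a j)
      ≡⟨ cong (filterᵇ P) (transposition-valid w a j w!a free (noOneBetween-true w a j zeros)) ⟩
    filterᵇ P (((w [ a ]≔ false) [ j ]≔ true) ∷ [])
      ≡⟨ cong (λ z → filterᵇ P ((z [ j ]≔ true) ∷ [])) cleared ⟩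
    filterᵇ P ((0ⁿ (suc M) [ j ]≔ true) ∷ [])
      ≡⟨ cong (λ z → filterᵇ P (z ∷ [])) (replicate-[]≔ (suc M) (s≤s j≤M)) ⟩
    filterᵇ P ((0ⁿ j ++ true ∷ 0ⁿ (M ∸ j)) ∷ [])
      ≡⟨ filterᵇ-singleton P (moved∈F j) ⟩
    (0ⁿ j ++ true ∷ 0ⁿ (M ∸ j)) ∷ []
      ≡⟨ cong (λ x → (0ⁿ x ++ true ∷ 0ⁿ (M ∸ j)) ∷ []) (m∸[m∸n]≡n j≤M) ⟨
    singleOne M (M ∸ j) ∷ []
      ≡⟨ cong (λ x → if x then [] else singleOne M (M ∸ j) ∷ []) (≡ᵇ-≢ M∸j≢c) ⟨
    atLevel (M ∸ j) ∎
    where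
    open ≡-Reasoning
    free : w ! j ≡ false
    free with w ! j in bit
    ... | false = refl
    ... | true = ⊥-elim (j≢a (only-one bit))
    zeros : ∀ m → between a j m ≡ true → w ! m ≡ false
    zeros m btw with w ! m in bit
    ... | false = refl
    ... | true with only-one bit | between⁻ a j m btw
    ...   | refl | inj₁ (a<a , _) = ⊥-elim (<-irrefl refl a<a)
    ...   | refl | inj₂ (_ , a<a) = ⊥-elim (<-irrefl refl a<a)
    M∸j≢c : M ∸ j ≢ c
    M∸j≢c eq = j≢a (trans (sym (m∸[m∸n]≡n j≤M)) (cong (M ∸_) eq))

  candidates-w : candidates 1 w ≡ descendingExcept (singleOne M) c M
  candidates-w = begin
    filterᵇ P (concatMap (transpositionsFrom w) (upTo (length w)))
      ≡⟨ filterᵇ-concatMap P (transpositionsFrom w) (upTo (length w)) ⟩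
    concatMap R (upTo (length w))
      ≡⟨ cong (concatMap R ∘ upTo) length-w ⟩
    concatMap R (upTo (a + suc c))
      ≡⟨ concatMap-upTo-+ R a (suc c) ⟩
    concatMap R (upTo a) ++ R (a + 0) ++ concatMap (R ∘ (a +_)) (applyUpTo suc c)
      ≡⟨ cong₂ (λ x z → x ++ R (a + 0) ++ z) (concatMap-[] (upTo a) (cong (filterᵇ P) ∘ transpositionsFrom-0 w ∘ w!<a ∘ ∈-upTo⁻))
               (concatMap-[] (applyUpTo suc c) after-one) ⟩
    R (a + 0) ++ []
      ≡⟨ trans (++-identityʳ _) (cong R (+-identityʳ a)) ⟩
    filterᵇ P (concatMap (transposition w a) (upTo (length w)))
      ≡⟨ filterᵇ-concatMap P (transposition w a) (upTo (length w)) ⟩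
    concatMap (filterᵇ P ∘ transposition w a) (upTo (length w))
      ≡⟨ cong (concatMap (filterᵇ P ∘ transposition w a) ∘ upTo) (trans length-w a+c) ⟩
    concatMap (filterᵇ P ∘ transposition w a) (upTo (suc M))
      ≡⟨ concatMap-levels (singleOne M) c M move ⟩
    descendingExcept (singleOne M) c M ∎
    where
    open ≡-Reasoning
    after-one : ∀ {x} → x ∈ applyUpTo suc c → R (a + x) ≡ []
    after-one x∈ with u , _ , refl ← ∈-applyUpTo⁻ suc x∈ =
      cong (filterᵇ P) (transpositionsFrom-0 w (trans (w!a+ (suc u)) (!-replicate c u)))

candidates-singleOne : ∀ {M c} → c ≤ M → candidates 1 (singleOne M c) ≡ descendingExcept (singleOne M) c M
candidates-singleOne c≤M = SingleOneCandidates.candidates-w c≤M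

-- The words of F(2, K + 1) and the special words

-- FWord K M y: y ∈ F_n(2, K + 1) for n = 2K + 1 + M, so M zeros are free to move.
record FWord (K M : ℕ) (y : List Bool) : Set where
  constructor fword
  field
    weight≡ : weightᴸ y ≡ suc K
    noAdj≡ : noAdj y ≡ true
    length≡ : length y ≡ suc (K + K) + M

inFᴸ-sound : ∀ k y → inFᴸ k y ≡ true → weightᴸ y ≡ k × noAdj y ≡ true
inFᴸ-sound k y ok with Equivalence.to Bool.T-∧ (Equivalence.from Bool.T-≡ ok)
... | w≡k , noAdj≡ = ≡ᵇ⇒≡ (weightᴸ y) k w≡k , Equivalence.to Bool.T-≡ noAdj≡

FWord⇒inFᴸ : ∀ {K M y} → FWord K M y → inFᴸ (suc K) y ≡ true
FWord⇒inFᴸ {K} {y = y} (fword w≡ noAdj≡ _) = cong₂ _∧_ (dec-true (weightᴸ y Data.Nat.≟ suc K) w≡) noAdj≡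

candidates⊆F : ∀ k x {y} → y ∈ candidates k x → inFᴸ k y ≡ true
candidates⊆F k x y∈ = Equivalence.to Bool.T-≡ (proj₂ (∈-filter⁻ (Bool.T? ∘ inFᴸ k) {xs = homTranspositionsᴸ x} y∈))

run-FWord : ∀ {K M x V e R} → GreedyRun (suc K) x V e R → FWord K M x → FWord K M e
run-FWord (stop _) x∈F = x∈F
run-FWord {K} {x = x} (step {y = y} next r) (fword _ _ length≡) = run-FWord r
  (fword (proj₁ inF) (proj₂ inF) (trans (candidates-length {suc K} {x} y∈) length≡))
  where
  y∈ : y ∈ candidates (suc K) x
  y∈ = proj₁ (firstNewᴸ-just (candidates (suc K) x) next)
  inF : weightᴸ y ≡ suc K × noAdj y ≡ true
  inF = inFᴸ-sound (suc K) y (candidates⊆F (suc K) x y∈)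

lastOne-split : ∀ y → 1 ≤ weightᴸ y → ∃₂ λ r d → y ≡ r ++ true ∷ 0ⁿ d
lastOne-split (false ∷ y) w≥1 with r , d , refl ← lastOne-split y w≥1 = false ∷ r , d , refl
lastOne-split (true ∷ y) _ with weightᴸ y ≟ 0
... | yes w≡0 = [] , length y , cong (true ∷_) (weightᴸ≡0 y w≡0)
... | no w≢0 with r , d , refl ← lastOne-split y (n≢0⇒n>0 w≢0) = true ∷ r , d , refl

lastOne : ∀ {K q} → weightᴸ q ≡ suc K → noAdj q ≡ true → LastOne K q
lastOne {K} {q} w≡ noAdj≡ with r , d , refl ← lastOne-split q (subst (1 ≤_) (sym w≡) (s≤s z≤n)) = record
  { prefix = r ; zeros = d ; split = refl
  ; weight-prefix = suc-injective (trans (sym (weightᴸ-++-1∷0ⁿ r d)) w≡)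
  ; noAdj-prefix1 = noAdj-prefix (r ++ true ∷ []) (0ⁿ d) (trans (cong noAdj (++-assoc r (true ∷ []) (0ⁿ d))) noAdj≡) }

ends-with-0 : ∀ r → 1 ≤ length r → noAdj (r ++ true ∷ []) ≡ true → ∃ λ q → r ≡ q ++ false ∷ []
ends-with-0 (false ∷ []) _ _ = [] , refl
ends-with-0 (x ∷ y ∷ r) _ ok with q , eq ← ends-with-0 (y ∷ r) (s≤s z≤n) (noAdj-tail x (y ∷ r ++ true ∷ []) ok) =
  x ∷ q , cong (x ∷_) eq

weightᴸ-appendOne : ∀ c q → weightᴸ (appendOne c q) ≡ suc (weightᴸ q)
weightᴸ-appendOne c q = begin
  weightᴸ (appendOne c q)                 ≡⟨ cong weightᴸ (++-assoc q (false ∷ []) (true ∷ 0ⁿ c)) ⟨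
  weightᴸ ((q ++ 0ⁿ 1) ++ true ∷ 0ⁿ c)    ≡⟨ weightᴸ-++-1∷0ⁿ (q ++ 0ⁿ 1) c ⟩
  suc (weightᴸ (q ++ 0ⁿ 1))               ≡⟨ cong suc (weightᴸ-++-0ⁿ q 1) ⟩
  suc (weightᴸ q)                         ∎
  where open ≡-Reasoning

noAdj-appendOne : ∀ c q → noAdj (appendOne c q) ≡ noAdj q
noAdj-appendOne c q rewrite noAdj-split q false (true ∷ 0ⁿ c) | noAdj-++-0 q | noAdj-1∷0ⁿ c = Bool.∧-identityʳ _

length-lower-bound : ∀ K q → weightᴸ q ≡ suc K → noAdj q ≡ true → suc (K + K) ≤ length q
length-lower-bound K q weight≡ noAdj≡ =
  subst (_≤ length q) (+-suc K K) (≤-pred (subst (λ w → w + w ≤ suc (length q)) weight≡ (noAdj-weight q noAdj≡)))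

split-length : ∀ {A L c M} → A ≤ L → L + c ≡ A + M → c ≤ M × L ≡ A + (M ∸ c)
split-length {A} {L} {c} {M} A≤L L+c≡ = c≤M , trans (sym (m+n∸n≡m L c)) (trans (cong (_∸ c) L+c≡) (+-∸-assoc A c≤M))
  where
  c≤M : c ≤ M
  c≤M = +-cancelˡ-≤ A c M (≤-trans (+-monoˡ-≤ c A≤L) (≤-reflexive L+c≡))

FWord-appendOne⁻ : ∀ {K M y} → FWord (suc K) M y → ∃₂ λ c q → c ≤ M × FWord K (M ∸ c) q × y ≡ appendOne c q
FWord-appendOne⁻ {K} {M} {y} (fword weight≡ noAdj≡ length≡)
  with record { prefix = r ; zeros = c ; split = refl ; weight-prefix = weight-r ; noAdj-prefix1 = noAdj-r1 } ← lastOne {q = y} weight≡ noAdj≡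
  with q , refl ← ends-with-0 r (≤-trans (subst (1 ≤_) (sym weight-r) (s≤s z≤n)) (weightᴸ≤length r)) noAdj-r1
  = c , q , proj₁ lengths , fword weight-q noAdj-q (proj₂ lengths) , y≡
  where
  y≡ : (q ++ false ∷ []) ++ true ∷ 0ⁿ c ≡ appendOne c q
  y≡ = ++-assoc q (false ∷ []) (true ∷ 0ⁿ c)
  weight-q : weightᴸ q ≡ suc K
  weight-q = trans (sym (weightᴸ-++-0ⁿ q 1)) weight-r
  noAdj-q : noAdj q ≡ true
  noAdj-q = noAdj-prefix q (false ∷ true ∷ 0ⁿ c) (trans (cong noAdj (sym y≡)) noAdj≡)
  length-q+c : length q + c ≡ suc (K + K) + M
  length-q+c = suc-injective (suc-injective (begin
    suc (suc (length q + c))                   ≡⟨ arith₁ (length q) c ⟩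
    length q + suc (suc c)                     ≡⟨ length-appendOne c q ⟨
    length (appendOne c q)                     ≡⟨ cong length y≡ ⟨
    length ((q ++ false ∷ []) ++ true ∷ 0ⁿ c)  ≡⟨ length≡ ⟩
    suc (suc K + suc K) + M                    ≡⟨ arith₂ K M ⟩
    suc (suc (suc (K + K) + M))                ∎))
    where
    open ≡-Reasoning
    arith₁ : ∀ L c → suc (suc (L + c)) ≡ L + suc (suc c)
    arith₁ = solve-∀
    arith₂ : ∀ K M → suc (suc K + suc K) + M ≡ suc (suc (suc (K + K) + M))
    arith₂ = solve-∀
  lengths : c ≤ M × length q ≡ suc (K + K) + (M ∸ c)
  lengths = split-length (length-lower-bound K q weight-q noAdj-q) length-q+c

specialPrefix : ℕ → ℕ → List Bool
specialPrefix zero j = 0ⁿ j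
specialPrefix (suc K) j = specialPrefix K j ++ true ∷ false ∷ []

-- special K M i = 0ⁱ 1 (01)ᴷ 0ᴹ⁻ⁱ
special : ℕ → ℕ → ℕ → List Bool
special K M i = specialPrefix K i ++ true ∷ 0ⁿ (M ∸ i)

weightᴸ-specialPrefix : ∀ K j → weightᴸ (specialPrefix K j) ≡ K
weightᴸ-specialPrefix zero j = weightᴸ-0ⁿ j
weightᴸ-specialPrefix (suc K) j =
  trans (weightᴸ-++-1∷0ⁿ (specialPrefix K j) 1) (cong suc (weightᴸ-specialPrefix K j))

noAdj-specialPrefix : ∀ K j → noAdj (specialPrefix K j ++ true ∷ []) ≡ true
noAdj-specialPrefix zero j = noAdj-0ⁿ-++ j (true ∷ [])
noAdj-specialPrefix (suc K) j
  rewrite ++-assoc (specialPrefix K j) (true ∷ false ∷ []) (true ∷ [])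
        | noAdj-split (specialPrefix K j) true (false ∷ true ∷ []) | noAdj-specialPrefix K j = refl

length-specialPrefix : ∀ K j → length (specialPrefix K j) ≡ j + (K + K)
length-specialPrefix zero j = trans (length-replicate j) (sym (+-identityʳ j))
length-specialPrefix (suc K) j = begin
  length (specialPrefix K j ++ true ∷ false ∷ [])  ≡⟨ length-++ (specialPrefix K j) ⟩
  length (specialPrefix K j) + 2                   ≡⟨ cong (_+ 2) (length-specialPrefix K j) ⟩
  j + (K + K) + 2                                  ≡⟨ arith j K ⟩
  j + (suc K + suc K)                              ∎
  where
  open ≡-Reasoning
  arith : ∀ j K → j + (K + K) + 2 ≡ j + (suc K + suc K)
  arith = solve-∀

prefix-lastOne : ∀ K j m → LastOne K (specialPrefix K j ++ true ∷ 0ⁿ m)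
prefix-lastOne K j m = record
  { prefix = specialPrefix K j ; zeros = m ; split = refl
  ; weight-prefix = weightᴸ-specialPrefix K j ; noAdj-prefix1 = noAdj-specialPrefix K j }

bottomWord : ℕ → ℕ → List Bool
bottomWord K a = specialPrefix K a ++ true ∷ []

special-bottom : ∀ K a → special K a a ≡ bottomWord K a
special-bottom K a = cong (λ x → specialPrefix K a ++ true ∷ 0ⁿ x) (n∸n≡0 a)

special-suc : ∀ K M i → special (suc K) M i ≡ appendOne (M ∸ i) (bottomWord K i)
special-suc K M i =
  trans (++-assoc (specialPrefix K i) (true ∷ false ∷ []) (true ∷ 0ⁿ (M ∸ i)))
        (sym (++-assoc (specialPrefix K i) (true ∷ []) (false ∷ true ∷ 0ⁿ (M ∸ i))))

prefix-special : ∀ K j m c b {M} → j + (m + c) ≡ M → specialPrefix K j ++ true ∷ 0ⁿ (m + c ∸ b) ≡ special K (M ∸ b) j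
prefix-special K j m c b {M} eq = cong (λ x → specialPrefix K j ++ true ∷ 0ⁿ x) (begin
  m + c ∸ b                  ≡⟨ [m+n]∸[m+o]≡n∸o j (m + c) b ⟨
  j + (m + c) ∸ (j + b)      ≡⟨ cong₂ _∸_ eq (+-comm j b) ⟩
  M ∸ (b + j)                ≡⟨ ∸-+-assoc M b j ⟨
  M ∸ b ∸ j                  ∎)
  where open ≡-Reasoning

special∈F : ∀ K {a j} → j ≤ a → FWord K a (special K a j)
special∈F K {a} {j} j≤a = fword
  (trans (weightᴸ-++-1∷0ⁿ (specialPrefix K j) (a ∸ j)) (cong suc (weightᴸ-specialPrefix K j)))
  (trans (noAdj-split (specialPrefix K j) true (0ⁿ (a ∸ j)))
         (cong₂ _∧_ (noAdj-specialPrefix K j) (noAdj-1∷0ⁿ (a ∸ j))))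
  (begin
    length (specialPrefix K j ++ true ∷ 0ⁿ (a ∸ j))     ≡⟨ length-++ (specialPrefix K j) ⟩
    length (specialPrefix K j) + suc (length (0ⁿ (a ∸ j))) ≡⟨ cong₂ (λ x y → x + suc y) (length-specialPrefix K j) (length-replicate (a ∸ j)) ⟩
    j + (K + K) + suc (a ∸ j)                          ≡⟨ arith j (K + K) (a ∸ j) ⟩
    suc (K + K) + (j + (a ∸ j))                        ≡⟨ cong (suc (K + K) +_) (m+[n∸m]≡n j≤a) ⟩
    suc (K + K) + a                                    ∎)
  where
  open ≡-Reasoning
  arith : ∀ j X d → j + X + suc d ≡ suc X + (j + d)
  arith = solve-∀

trailingZeros-special : ∀ K a j → trailingZeros (special K a j) ≡ a ∸ j
trailingZeros-special K a j = trailingZeros-1∷0ⁿ (specialPrefix K j) (a ∸ j)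

special-injective : ∀ K {M i i′} → i ≤ M → i′ ≤ M → special K M i ≡ special K M i′ → i ≡ i′
special-injective K {M} {i} {i′} i≤M i′≤M eq = begin
  i                ≡⟨ m∸[m∸n]≡n i≤M ⟨
  M ∸ (M ∸ i)      ≡⟨ cong (M ∸_) (trans (sym (trailingZeros-special K M i)) (trans (cong trailingZeros eq) (trailingZeros-special K M i′))) ⟩
  M ∸ (M ∸ i′)     ≡⟨ m∸[m∸n]≡n i′≤M ⟩
  i′               ∎
  where open ≡-Reasoning

concat-replicate-suc : ∀ {A : Set} K (xs : List A) → concat (replicate (suc K) xs) ≡ concat (replicate K xs) ++ xs
concat-replicate-suc zero xs = ++-identityʳ xs
concat-replicate-suc (suc K) xs = trans (cong (xs ++_) (concat-replicate-suc K xs)) (sym (++-assoc xs _ xs))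

specialWord≡special : ∀ n K i → specialWord n (suc K) i ≡ special K (n ∸ (2 * suc K ∸ 1)) i
specialWord≡special n K i = shape K (0ⁿ (n ∸ (2 * suc K ∸ 1) ∸ i))
  where
  shape : ∀ K Z → 0ⁿ i ++ (true ∷ concat (replicate K (false ∷ true ∷ []))) ++ Z ≡ specialPrefix K i ++ true ∷ Z
  shape zero Z = refl
  shape (suc K) Z = begin
    0ⁿ i ++ (true ∷ concat (replicate (suc K) zeroOne)) ++ Z   ≡⟨ cong (λ x → 0ⁿ i ++ (true ∷ x) ++ Z) (concat-replicate-suc K zeroOne) ⟩
    0ⁿ i ++ (true ∷ concat (replicate K zeroOne) ++ zeroOne) ++ Z   ≡⟨ cong (0ⁿ i ++_) (cong (true ∷_) (++-assoc (concat (replicate K zeroOne)) zeroOne Z)) ⟩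
    0ⁿ i ++ (true ∷ concat (replicate K zeroOne)) ++ zeroOne ++ Z   ≡⟨ shape K (zeroOne ++ Z) ⟩
    specialPrefix K i ++ true ∷ false ∷ true ∷ Z           ≡⟨ ++-assoc (specialPrefix K i) (true ∷ false ∷ []) (true ∷ Z) ⟨
    specialPrefix (suc K) i ++ true ∷ Z                    ∎
    where
    open ≡-Reasoning
    zeroOne : List Bool
    zeroOne = false ∷ true ∷ []

FWord-zero⁻ : ∀ {M y} → FWord 0 M y → ∃ λ j → j ≤ M × y ≡ special 0 M j
FWord-zero⁻ {M} {y} (fword weight≡ _ length≡)
  with r , d , refl ← lastOne-split y (subst (1 ≤_) (sym weight≡) (s≤s z≤n))
  = length r , j≤M , cong₂ (λ u v → u ++ true ∷ 0ⁿ v) r≡0ⁿ d≡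
  where
  r≡0ⁿ : r ≡ 0ⁿ (length r)
  r≡0ⁿ = weightᴸ≡0 r (suc-injective (trans (sym (weightᴸ-++-1∷0ⁿ r d)) weight≡))
  j+d : length r + d ≡ M
  j+d = suc-injective (begin
    suc (length r + d)                  ≡⟨ +-suc (length r) d ⟨
    length r + suc d                    ≡⟨ cong (λ x → length r + suc x) (length-replicate d) ⟨
    length r + length (true ∷ 0ⁿ d)     ≡⟨ length-++ r ⟨
    length (r ++ true ∷ 0ⁿ d)           ≡⟨ length≡ ⟩
    suc M                               ∎)
    where open ≡-Reasoning
  j≤M : length r ≤ M
  j≤M = subst (length r ≤_) j+d (m≤m+n _ d)
  d≡ : d ≡ M ∸ length r
  d≡ = sym (trans (cong (_∸ length r) (sym j+d)) (m+n∸m≡n (length r) d))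

lastOne-bottom : ∀ {K a e} → FWord K a e → trailingZeros e ≡ 0 → LastOne K e
lastOne-bottom {K} {a} {e} (fword weight≡ noAdj≡ _) e-level = record
  { prefix = prefix ; zeros = 0 ; split = trans split (cong (λ d → prefix ++ true ∷ 0ⁿ d) zeros≡0)
  ; weight-prefix = weight-prefix ; noAdj-prefix1 = noAdj-prefix1 }
  where
  open LastOne (lastOne {q = e} weight≡ noAdj≡)
  zeros≡0 : zeros ≡ 0
  zeros≡0 = trans (sym (trailingZeros-1∷0ⁿ prefix zeros)) (trans (cong trailingZeros (sym split)) e-level)

FWord-shift : ∀ {K a r d} → FWord K a (r ++ true ∷ 0ⁿ d) → FWord K (suc a) (r ++ true ∷ 0ⁿ (suc d))
FWord-shift {K} {a} {r} {d} (fword weight≡ noAdj≡ length≡) = fword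
  (trans (weightᴸ-++-1∷0ⁿ r (suc d)) (trans (sym (weightᴸ-++-1∷0ⁿ r d)) weight≡))
  (trans (noAdj-split r true (0ⁿ (suc d))) (cong₂ _∧_ (noAdj-prefix (r ++ true ∷ []) (0ⁿ d) r1-ok) (noAdj-1∷0ⁿ (suc d))))
  (begin
    length (r ++ true ∷ 0ⁿ (suc d))       ≡⟨ length-++ r ⟩
    length r + suc (suc (length (0ⁿ d)))  ≡⟨ +-suc (length r) _ ⟩
    suc (length r + suc (length (0ⁿ d)))  ≡⟨ cong suc (length-++ r) ⟨
    suc (length (r ++ true ∷ 0ⁿ d))       ≡⟨ cong suc length≡ ⟩
    suc (suc (K + K) + a)                 ≡⟨ +-suc (suc (K + K)) a ⟨
    suc (K + K) + suc a                   ∎)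
  where
  open ≡-Reasoning
  r1-ok : noAdj ((r ++ true ∷ []) ++ 0ⁿ d) ≡ true
  r1-ok = trans (cong noAdj (++-assoc r (true ∷ []) (0ⁿ d))) noAdj≡

-- Runs inside a level

LevelAvoided : List (List Bool) → ℕ → Set
LevelAvoided V b = ∀ {z} → z ∈ V → trailingZeros z ≢ b

∈-map-appendOne : ∀ {b Rs z} → z ∈ map (appendOne b) Rs → trailingZeros z ≡ b
∈-map-appendOne {b} z∈ with w , _ , refl ← ∈-map⁻ (appendOne b) z∈ = trailingZeros-appendOne b w

∈-lifted⁻ : ∀ {c x Vs V′} → LevelAvoided V′ c → appendOne c x ∈ map (appendOne c) Vs ++ V′ → x ∈ Vs
∈-lifted⁻ {c} {x} {Vs} avoid x∈ with ∈-++⁻ (map (appendOne c) Vs) x∈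
... | inj₂ x∈V′ = ⊥-elim (avoid x∈V′ (trailingZeros-appendOne c x))
... | inj₁ x∈map with z , z∈ , eq ← ∈-map⁻ (appendOne c) x∈map = subst (_∈ Vs) (sym (appendOne-injective c eq)) z∈

firstNewᴸ-lifted : ∀ {c V′} xs Vs {y} → LevelAvoided V′ c → firstNewᴸ xs Vs ≡ just y →
  firstNewᴸ (map (appendOne c) xs) (map (appendOne c) Vs ++ V′) ≡ just (appendOne c y)
firstNewᴸ-lifted {c} {V′} (x ∷ xs) Vs avoid found with x ∈? Vs | appendOne c x ∈? (map (appendOne c) Vs ++ V′)
... | yes _ | yes _ = firstNewᴸ-lifted xs Vs avoid found
... | no _ | no _ = cong (just ∘ appendOne c) (just-injective found)
... | yes x∈ | no x∉ = ⊥-elim (x∉ (∈-++⁺ˡ (∈-map⁺ (appendOne c) x∈)))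
... | no x∉ | yes x∈ = ⊥-elim (x∉ (∈-lifted⁻ avoid x∈))

inFᴸ-lastOne : ∀ {K q} → inFᴸ (suc K) q ≡ true → LastOne K q
inFᴸ-lastOne {K} {q} ok = let (w≡ , noAdj≡) = inFᴸ-sound (suc K) q ok in lastOne {q = q} w≡ noAdj≡

-- A run of q lifts to a run from appendOne c q, as long as no other word of level c has been visited.
run-lifted : ∀ {K c q Vs e Rs} → GreedyRun (suc K) q Vs e Rs → inFᴸ (suc K) q ≡ true →
  ∀ {V′} → LevelAvoided V′ c →
  ∀ {e′ R} → GreedyRun (suc (suc K)) (appendOne c e) (map (appendOne c) Rs ++ V′) e′ R →
  GreedyRun (suc (suc K)) (appendOne c q) (map (appendOne c) Vs ++ V′) e′ R
run-lifted (stop _) _ _ continue = continue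
run-lifted {K} {c} {q} {Vs} (step {y = y} next r) q∈F {V′} avoid continue =
  step (begin
    firstNewᴸ (candidates (suc (suc K)) (appendOne c q)) W
      ≡⟨ cong (λ z → firstNewᴸ z W) (candidates-appendOne (inFᴸ-lastOne {K} {q} q∈F) c) ⟩
    firstNewᴸ (map (appendOne c) (candidates (suc K) q) ++ lastOneMoves (inFᴸ-lastOne {K} {q} q∈F) c) W
      ≡⟨ firstNewᴸ-++-just (map (appendOne c) (candidates (suc K) q)) (lastOneMoves (inFᴸ-lastOne {K} {q} q∈F) c)
                           (firstNewᴸ-lifted (candidates (suc K) q) Vs avoid next) ⟩
    just (appendOne c y) ∎)
    (run-lifted r (candidates⊆F (suc K) q (proj₁ (firstNewᴸ-just (candidates (suc K) q) next))) avoid continue)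
  where
  open ≡-Reasoning
  W : List (List Bool)
  W = map (appendOne c) Vs ++ V′

run-lifted-end : ∀ {K c q Vs e Rs} → GreedyRun (suc K) q Vs e Rs → ∀ V′ →
  map (appendOne c) (candidates (suc K) e) ⊆ map (appendOne c) Rs ++ V′
run-lifted-end {K} {c} {e = e} r V′ y∈ with x , x∈ , refl ← ∈-map⁻ (appendOne c) y∈ =
  ∈-++⁺ˡ (∈-map⁺ (appendOne c) (firstNewᴸ-nothing (candidates (suc K) e) (run-end r) x∈))

firstNewᴸ-lastOne : ∀ {K c e W} (D : LastOne K e) → map (appendOne c) (candidates (suc K) e) ⊆ W →
  firstNewᴸ (candidates (suc (suc K)) (appendOne c e)) W ≡ firstNewᴸ (lastOneMoves D c) W
firstNewᴸ-lastOne {K} {c} {e} {W} D visited =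
  trans (cong (λ z → firstNewᴸ z W) (candidates-appendOne D c))
        (firstNewᴸ-++ˡ (map (appendOne c) (candidates (suc K) e)) (lastOneMoves D c) visited)

data DescendingChoice (f : ℕ → List Bool) (c n : ℕ) (V : List (List Bool)) : Set where
  allVisited : firstNewᴸ (descendingExcept f c n) V ≡ nothing →
               (∀ {b} → b ≤ n → b ≢ c → f b ∈ V) → DescendingChoice f c n V
  highestUnvisited : ∀ b → b ≤ n → b ≢ c → f b ∉ V → firstNewᴸ (descendingExcept f c n) V ≡ just (f b) →
                     (∀ {b′} → b < b′ → b′ ≤ n → b′ ≢ c → f b′ ∈ V) → DescendingChoice f c n V

descendingChoice : ∀ f c n V → DescendingChoice f c n V
descendingChoice f c zero V with 0 ≟ c
... | yes refl = allVisited refl λ { z≤n 0≢0 → ⊥-elim (0≢0 refl) }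
... | no 0≢c with f 0 ∈? V
...   | yes f0∈ = allVisited (trans (cong (λ l → firstNewᴸ l V) (descendingExcept-keep₀ f 0≢c)) (firstNewᴸ-∈ [] f0∈))
                             λ { z≤n _ → f0∈ }
...   | no f0∉ = highestUnvisited 0 z≤n 0≢c f0∉
                   (trans (cong (λ l → firstNewᴸ l V) (descendingExcept-keep₀ f 0≢c)) (firstNewᴸ-∉ [] f0∉))
                   λ 0<b b≤0 _ → ⊥-elim (<⇒≱ 0<b b≤0)
descendingChoice f c (suc n) V with suc n ≟ c | descendingChoice f c n V
... | yes refl | allVisited none visited =
  allVisited (trans (cong (λ l → firstNewᴸ l V) (descendingExcept-skip f n)) none) λ b≤ b≢ → visited (below b≤ b≢) b≢
  where
  below : ∀ {b} → b ≤ suc n → b ≢ suc n → b ≤ n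
  below b≤ b≢ = ≤-pred (≤∧≢⇒< b≤ b≢)
... | yes refl | highestUnvisited b b≤n b≢ b∉ found above =
  highestUnvisited b (m≤n⇒m≤1+n b≤n) b≢ b∉ (trans (cong (λ l → firstNewᴸ l V) (descendingExcept-skip f n)) found)
    λ b<b′ b′≤ b′≢ → above b<b′ (≤-pred (≤∧≢⇒< b′≤ b′≢)) b′≢
... | no sn≢c | rec with f (suc n) ∈? V
...   | no fsn∉ = highestUnvisited (suc n) ≤-refl sn≢c fsn∉
                    (trans (cong (λ l → firstNewᴸ l V) (descendingExcept-keep f n sn≢c)) (firstNewᴸ-∉ (descendingExcept f c n) fsn∉))
                    λ lt le _ → ⊥-elim (<⇒≱ lt le)
...   | yes fsn∈ with rec
...     | allVisited none visited =
  allVisited (trans (cong (λ l → firstNewᴸ l V) (descendingExcept-keep f n sn≢c)) (trans (firstNewᴸ-∈ (descendingExcept f c n) fsn∈) none))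
    λ {b} b≤ b≢ → [ (λ b<sn → visited (≤-pred b<sn) b≢) , (λ { refl → fsn∈ }) ]′ (m≤n⇒m<n∨m≡n b≤)
...     | highestUnvisited b b≤n b≢ b∉ found above =
  highestUnvisited b (m≤n⇒m≤1+n b≤n) b≢ b∉
    (trans (cong (λ l → firstNewᴸ l V) (descendingExcept-keep f n sn≢c)) (trans (firstNewᴸ-∈ (descendingExcept f c n) fsn∈) found))
    λ {b′} b<b′ b′≤ b′≢ → [ (λ b′<sn → above b<b′ (≤-pred b′<sn) b′≢) , (λ { refl → fsn∈ }) ]′ (m≤n⇒m<n∨m≡n b′≤)

firstNewᴸ-highest : ∀ f {c n V} → n ≢ c → f n ∉ V → firstNewᴸ (descendingExcept f c n) V ≡ just (f n)
firstNewᴸ-highest f {c} {zero} {V} 0≢c f0∉ =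
  trans (cong (λ l → firstNewᴸ l V) (descendingExcept-keep₀ f 0≢c)) (firstNewᴸ-∉ [] f0∉)
firstNewᴸ-highest f {c} {suc n} {V} n≢c fn∉ =
  trans (cong (λ l → firstNewᴸ l V) (descendingExcept-keep f n n≢c)) (firstNewᴸ-∉ (descendingExcept f c n) fn∉)

-- Traversals and the case of a single 1

-- The run from special K M i stops at the bottom word special K M M, except when it starts there:
-- then it stops one level up for even K and at the top for odd K.
endsOnTop : ℕ → Bool
endsOnTop zero = false
endsOnTop (suc K) = not (endsOnTop K)

lastIndexFromBottom : ℕ → ℕ → ℕ
lastIndexFromBottom K zero = 0
lastIndexFromBottom K (suc M) = if endsOnTop K then 0 else M

lastIndex : ℕ → ℕ → ℕ → ℕ
lastIndex K M i = if i <ᵇ M then M else lastIndexFromBottom K M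

lastIndex≤ : ∀ K {M i} → i ≤ M → lastIndex K M i ≤ M
lastIndex≤ K {M} {i} i≤M with i <ᵇ M
... | true = ≤-refl
... | false = bottom M
  where
  bottom : ∀ M → lastIndexFromBottom K M ≤ M
  bottom zero = z≤n
  bottom (suc M) with endsOnTop K
  ... | true = z≤n
  ... | false = n≤1+n M

record Traversal (K M i : ℕ) : Set where
  field
    last : List Bool
    visited : List (List Bool)
    run : GreedyRun (suc K) (special K M i) (special K M i ∷ []) last visited
    covers : ∀ {y} → FWord K M y → y ∈ visited
    last≡ : last ≡ special K M (lastIndex K M i)

lastIndex-< : ∀ K {M i} → i < M → lastIndex K M i ≡ M
lastIndex-< K i<M rewrite <ᵇ-true i<M = refl

lastIndex-bottom : ∀ K M → lastIndex K M M ≡ lastIndexFromBottom K M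
lastIndex-bottom K M rewrite <ᵇ-false (≤-refl {M}) = refl

lastIndex-bottom-zero : ∀ M → lastIndex 0 M M ≡ pred M
lastIndex-bottom-zero zero = refl
lastIndex-bottom-zero (suc M) = lastIndex-bottom 0 (suc M)

suc-pred-∸ : ∀ {M} → M ≢ 0 → M ∸ pred M ≡ 1
suc-pred-∸ {zero} M≢0 = ⊥-elim (M≢0 refl)
suc-pred-∸ {suc M} _ = go M
  where
  go : ∀ m → suc m ∸ m ≡ 1
  go zero = refl
  go (suc m) = go m

trailingZeros-singleOne : ∀ M l → trailingZeros (singleOne M l) ≡ l
trailingZeros-singleOne M l = trailingZeros-1∷0ⁿ (0ⁿ (M ∸ l)) l

singleOne-injective : ∀ M {a b} → singleOne M a ≡ singleOne M b → a ≡ b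
singleOne-injective M {a} {b} eq =
  trans (sym (trailingZeros-singleOne M a)) (trans (cong trailingZeros eq) (trailingZeros-singleOne M b))

special-singleOne : ∀ {M i} → i ≤ M → special 0 M i ≡ singleOne M (M ∸ i)
special-singleOne {M} {i} i≤M = cong (λ x → 0ⁿ x ++ true ∷ 0ⁿ (M ∸ i)) (sym (m∸[m∸n]≡n i≤M))

module BaseCase (M : ℕ) where

  record Descent (c : ℕ) (V : List (List Bool)) : Set where
    field
      last : List Bool
      visited : List (List Bool)
      run : GreedyRun 1 (singleOne M c) V last visited
      covers : ∀ {b} → b ≤ M → singleOne M b ∈ visited
      lastLevel : ℕ
      lastLevel≤M : lastLevel ≤ M
      last≡ : last ≡ singleOne M lastLevel
      visited-below : ∀ {b} → b < lastLevel → singleOne M b ∈ V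
      new-or-all : (lastLevel ≡ c × (∀ {b} → b ≤ M → b ≢ c → singleOne M b ∈ V)) ⊎ singleOne M lastLevel ∉ V

  -- The run goes to the highest unvisited level, so it visits them in decreasing order.
  descent : ∀ n {c V} → c ≤ M → singleOne M c ∈ V → (∀ {b} → n ≤ b → b ≤ M → singleOne M b ∈ V) → Descent c V
  descent n {c} {V} c≤M c∈V above with descendingChoice (singleOne M) c M V
  ... | allVisited none visited = record
    { run = stop (trans (cong (λ l → firstNewᴸ l V) (candidates-singleOne c≤M)) none)
    ; covers = λ {b} b≤M → case b ≟ c of λ { (yes refl) → c∈V ; (no b≢c) → visited b≤M b≢c }
    ; lastLevel = c ; lastLevel≤M = c≤M ; last≡ = refl
    ; visited-below = λ {b} b<c → visited (≤-trans (<⇒≤ b<c) c≤M) (<⇒≢ b<c)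
    ; new-or-all = inj₁ (refl , visited) }
  ... | highestUnvisited b b≤M b≢c b∉ found higher with n
  ...   | zero = ⊥-elim (b∉ (above z≤n b≤M))
  ...   | suc n′ = record
    { run = step (trans (cong (λ l → firstNewᴸ l V) (candidates-singleOne c≤M)) found) (run D)
    ; covers = covers D
    ; lastLevel = lastLevel D ; lastLevel≤M = lastLevel≤M D ; last≡ = last≡ D
    ; visited-below = λ b′<last → case visited-below D b′<last of λ
        { (here eq) → ⊥-elim (<⇒≢ (<-≤-trans b′<last last≤b) (singleOne-injective M eq))
        ; (there b′∈) → b′∈ }
    ; new-or-all = inj₂ (case new-or-all D of λ
        { (inj₁ (last≡b , _)) → subst (λ l → singleOne M l ∉ V) (sym last≡b) b∉
        ; (inj₂ last∉) → last∉ ∘ there }) }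
    where
    open Descent
    b≤n′ : b ≤ n′
    b≤n′ = ≮⇒≥ λ n′<b → b∉ (above n′<b b≤M)
    all-from-b : ∀ {l} → b ≤ l → l ≤ M → singleOne M l ∈ singleOne M b ∷ V
    all-from-b {l} b≤l l≤M with m≤n⇒m<n∨m≡n b≤l | l ≟ c
    ... | inj₂ refl | _ = here refl
    ... | inj₁ _ | yes refl = there c∈V
    ... | inj₁ b<l | no l≢c = there (higher b<l l≤M l≢c)
    D : Descent b (singleOne M b ∷ V)
    D = descent n′ b≤M (here refl) (λ n′≤l → all-from-b (≤-trans b≤n′ n′≤l))
    last≤b : lastLevel D ≤ b
    last≤b = case new-or-all D of λ
      { (inj₁ (eq , _)) → ≤-reflexive eq
      ; (inj₂ last∉) → ≮⇒≥ λ b<last → last∉ (all-from-b (<⇒≤ b<last) (lastLevel≤M D)) }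

traversal-zero : ∀ M {i} → i ≤ M → Traversal 0 M i
traversal-zero M {i} i≤M = record
  { run = subst (λ w → GreedyRun 1 w (w ∷ []) (last D) (visited D)) (sym (special-singleOne i≤M)) (run D)
  ; covers = λ y∈F → case FWord-zero⁻ y∈F of λ
      { (j , j≤M , refl) → subst (_∈ visited D) (sym (special-singleOne j≤M)) (covers D (m∸n≤m M j)) }
  ; last≡ = trans (last≡ D) (trans (cong (singleOne M) lastLevel≡) (sym (special-singleOne (lastIndex≤ 0 i≤M)))) }
  where
  open BaseCase.Descent
  c₀ : ℕ
  c₀ = M ∸ i
  D : BaseCase.Descent M c₀ (singleOne M c₀ ∷ [])
  D = BaseCase.descent M (suc M) (m∸n≤m M i) (here refl) (λ M<b b≤M → ⊥-elim (<⇒≱ M<b b≤M))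
  only-start : ∀ {b} → singleOne M b ∈ singleOne M c₀ ∷ [] → b ≡ c₀
  only-start (here eq) = singleOne-injective M eq
  lastLevel≡ : lastLevel D ≡ M ∸ lastIndex 0 M i
  lastLevel≡ with i <? M
  ... | yes i<M = begin
    lastLevel D  ≡⟨ n≤0⇒n≡0 (≮⇒≥ λ 0<last → <⇒≢ (m<n⇒0<n∸m i<M) (only-start (visited-below D 0<last))) ⟩
    0            ≡⟨ n∸n≡0 M ⟨
    M ∸ M        ≡⟨ cong (M ∸_) (lastIndex-< 0 i<M) ⟨
    M ∸ lastIndex 0 M i ∎
    where open ≡-Reasoning
  ... | no i≮M with refl ← ≤-antisym i≤M (≮⇒≥ i≮M) = trans level (cong (M ∸_) (sym (lastIndex-bottom-zero M)))
    where
    c₀≡0 : c₀ ≡ 0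
    c₀≡0 = n∸n≡0 M
    1≢c₀ : 1 ≢ c₀
    1≢c₀ eq = 1+n≢0 (trans eq c₀≡0)
    level : lastLevel D ≡ M ∸ pred M
    level with M ≟ 0
    ... | yes M≡0 = trans (n≤0⇒n≡0 (subst (lastLevel D ≤_) M≡0 (lastLevel≤M D))) (sym (cong (λ m → m ∸ pred m) M≡0))
    ... | no M≢0 = trans level1 (sym (suc-pred-∸ M≢0))
      where
      level1 : lastLevel D ≡ 1
      level1 = case new-or-all D of λ
        { (inj₁ (_ , all)) → ⊥-elim (1≢c₀ (only-start (all (n≢0⇒n>0 M≢0) 1≢c₀)))
        ; (inj₂ last∉) → ≤-antisym (≮⇒≥ λ 1<L → 1≢c₀ (only-start (visited-below D 1<L)))
                                   (n≢0⇒n>0 λ L≡0 → last∉ (subst (λ l → singleOne M l ∈ singleOne M c₀ ∷ [])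
                                                                 (sym (trans L≡0 (sym c₀≡0))) (here refl))) }

lastIndex-zero : ∀ K M → lastIndex K M 0 ≡ M
lastIndex-zero K zero = refl
lastIndex-zero K (suc M) = refl

lastIndex-full : ∀ K {M i} → i ≤ M → M ∸ i ≡ 0 → lastIndex K M i ≡ lastIndexFromBottom K M
lastIndex-full K {M} {i} i≤M M∸i≡0 = trans (cong (lastIndex K M) (≤-antisym i≤M (m∸n≡0⇒m≤n M∸i≡0))) (lastIndex-bottom K M)

lastIndex-partial : ∀ K {M i} → M ∸ i ≢ 0 → lastIndex K M i ≡ M
lastIndex-partial K {M} {i} M∸i≢0 = lastIndex-< K (≰⇒> λ M≤i → M∸i≢0 (m≤n⇒m∸n≡0 M≤i))

lastIndexFromBottom-suc : ∀ K {M} → 0 < M → lastIndexFromBottom (suc K) M ≡ (if endsOnTop K then pred M else 0)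
lastIndexFromBottom-suc K {suc M} _ with endsOnTop K
... | true = refl
... | false = refl

-- From K + 1 to K + 2 ones

module Step (K : ℕ) (traversal : ∀ a {j} → j ≤ a → Traversal K a j) (M : ℕ) where

  open Traversal

  LevelCovered : List (List Bool) → ℕ → Set
  LevelCovered V b = ∀ {y} → FWord K (M ∸ b) y → appendOne b y ∈ V

  Settled : List (List Bool) → ℕ → Set
  Settled V c = ∀ {b} → b < c → LevelCovered V b ⊎ LevelAvoided V b

  -- the run of the lower words inside level c, stopped at e, has no new candidate left
  Exhausted : ℕ → List Bool → List (List Bool) → Set
  Exhausted c e V = map (appendOne c) (candidates (suc K) e) ⊆ V

  covered-avoided : ∀ {V b} → LevelCovered V b → LevelAvoided V b → ⊥
  covered-avoided {b = b} covered avoided =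
    avoided (covered (special∈F K {M ∸ b} {0} z≤n)) (trailingZeros-appendOne b (special K (M ∸ b) 0))

  covered-⊆ : ∀ {V W b} → V ⊆ W → LevelCovered V b → LevelCovered W b
  covered-⊆ V⊆W covered = V⊆W ∘ covered

  lifted-avoids : ∀ {b b′ Rs V} → b′ ≢ b → LevelAvoided V b′ → LevelAvoided (map (appendOne b) Rs ++ V) b′
  lifted-avoids {b} {Rs = Rs} b′≢b avoided z∈ with ∈-++⁻ (map (appendOne b) Rs) z∈
  ... | inj₁ z∈map = λ eq → b′≢b (trans (sym eq) (∈-map-appendOne z∈map))
  ... | inj₂ z∈V = avoided z∈V

  lifted-covers⁻ : ∀ {b b′ Rs V} → b′ ≢ b → LevelCovered (map (appendOne b) Rs ++ V) b′ → LevelCovered V b′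
  lifted-covers⁻ {b} {b′} {Rs} b′≢b covered {y} y∈F with ∈-++⁻ (map (appendOne b) Rs) (covered y∈F)
  ... | inj₁ y∈map = ⊥-elim (b′≢b (trans (sym (trailingZeros-appendOne b′ y)) (∈-map-appendOne y∈map)))
  ... | inj₂ y∈V = y∈V

  bottom : ℕ → List Bool
  bottom c = appendOne c (bottomWord K (M ∸ c))

  bottom≡special : ∀ {c} → c ≤ M → bottom c ≡ special (suc K) M (M ∸ c)
  bottom≡special {c} c≤M = sym (trans (special-suc K M (M ∸ c))
    (cong (λ x → appendOne x (bottomWord K (M ∸ c))) (m∸[m∸n]≡n c≤M)))

  -- Level b entered at special K a j (with a = M ∸ b) is swept by the lower run from that word.
  module Sweep (b : ℕ) {a j : ℕ} (M∸b≡a : M ∸ b ≡ a) (j≤a : j ≤ a) where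

    T : Traversal K a j
    T = traversal a j≤a

    after : List (List Bool) → List (List Bool)
    after V = map (appendOne b) (visited T) ++ V

    covers-level : ∀ {V} → LevelCovered (after V) b
    covers-level {y = y} y∈F = ∈-++⁺ˡ (∈-map⁺ (appendOne b) (covers T (subst (λ m → FWord K m y) M∸b≡a y∈F)))

    keeps : ∀ {V} → V ⊆ after V
    keeps = ∈-++⁺ʳ (map (appendOne b) (visited T))

    keeps-avoided : ∀ {V b′} → b′ ≢ b → LevelAvoided V b′ → LevelAvoided (after V) b′
    keeps-avoided = lifted-avoids {Rs = visited T}

    only-level : ∀ {b′} → b′ ≢ b → LevelAvoided (after []) b′
    only-level b′≢b = keeps-avoided b′≢b (λ ())

    exhausted : ∀ {V e} → last T ≡ e → Exhausted b e (after V)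
    exhausted {V} refl = run-lifted-end (run T) V

    last-bottom : j < a → last T ≡ bottomWord K a
    last-bottom j<a = trans (last≡ T) (trans (cong (special K a) (lastIndex-< K j<a)) (special-bottom K a))

    last-from-bottom : last T ≡ special K a (lastIndex K a j)
    last-from-bottom = last≡ T

    enter : ∀ {x V e R} → firstNewᴸ (candidates (suc (suc K)) x) V ≡ just (appendOne b (special K a j)) →
            LevelAvoided V b → GreedyRun (suc (suc K)) (appendOne b (last T)) (after V) e R →
            GreedyRun (suc (suc K)) x V e R
    enter first avoided rest = step first (run-lifted (run T) (FWord⇒inFᴸ (special∈F K j≤a)) avoided rest)

  StopsAt : List (List Bool) → ℕ → ℕ → Set
  StopsAt V c L = (∀ {b} → b < L → LevelCovered V b) × (L ≡ c ⊎ (L < c × LevelAvoided V L))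

  StopsAt-not-below : ∀ {V c L L′} → StopsAt V c L → StopsAt V c L′ → ¬ L < L′
  StopsAt-not-below (_ , inj₁ refl) (_ , stops′) L<L′ = <⇒≱ L<L′ ([ ≤-reflexive , <⇒≤ ∘ proj₁ ]′ stops′)
  StopsAt-not-below (_ , inj₂ (_ , avoided)) (below′ , _) L<L′ = covered-avoided (below′ L<L′) avoided

  StopsAt-unique : ∀ {V c L L′} → StopsAt V c L → StopsAt V c L′ → L ≡ L′
  StopsAt-unique s s′ = ≤-antisym (≮⇒≥ (StopsAt-not-below s′ s)) (≮⇒≥ (StopsAt-not-below s s′))

  record Descent (c : ℕ) (V : List (List Bool)) : Set where
    field
      last : List Bool
      visited : List (List Bool)
      run : GreedyRun (suc (suc K)) (bottom c) V last visited
      covers-below : ∀ {b} → b < c → LevelCovered visited b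
      lastLevel : ℕ
      last≡ : last ≡ bottom lastLevel
      stops : StopsAt V c lastLevel

  DescentFrom : ℕ → Set
  DescentFrom c = ∀ {V} → c ≤ M → Exhausted c (bottomWord K (M ∸ c)) V → Settled V c → Descent c V

  fromBottom : ℕ → ℕ → List Bool
  fromBottom c b = appendOne b (specialPrefix K (M ∸ c) ++ true ∷ 0ⁿ (c ∸ b))

  trailingZeros-fromBottom : ∀ c b → trailingZeros (fromBottom c b) ≡ b
  trailingZeros-fromBottom c b = trailingZeros-appendOne b (specialPrefix K (M ∸ c) ++ true ∷ 0ⁿ (c ∸ b))

  firstNew-fromBottom : ∀ {c V} → Exhausted c (bottomWord K (M ∸ c)) V →
    firstNewᴸ (candidates (suc (suc K)) (bottom c)) V ≡ firstNewᴸ (descendingExcept (fromBottom c) c c) V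
  firstNew-fromBottom {c} = firstNewᴸ-lastOne (prefix-lastOne K (M ∸ c) 0)

  descent-stop : ∀ {c V} → Exhausted c (bottomWord K (M ∸ c)) V → Settled V c →
    firstNewᴸ (descendingExcept (fromBottom c) c c) V ≡ nothing → (∀ {b} → b ≤ c → b ≢ c → fromBottom c b ∈ V) →
    Descent c V
  descent-stop {c} {V} exhausted settled none visited = record
    { run = stop (trans (firstNew-fromBottom exhausted) none)
    ; covers-below = covered
    ; lastLevel = c ; last≡ = refl ; stops = covered , inj₁ refl }
    where
    covered : ∀ {b} → b < c → LevelCovered V b
    covered {b} b<c with settled b<c
    ... | inj₁ cov = cov
    ... | inj₂ avoided = ⊥-elim (avoided (visited (<⇒≤ b<c) (<⇒≢ b<c)) (trailingZeros-fromBottom c b))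

  -- The run enters the highest level b < c that is not covered, sweeps it, and descends from its bottom.
  module Enter {c V} (descent′ : ∀ {b} → b < c → DescentFrom b) (c≤M : c ≤ M)
               (exhausted : Exhausted c (bottomWord K (M ∸ c)) V) (settled : Settled V c)
               {b} (b≤c : b ≤ c) (b≢c : b ≢ c) (b∉ : fromBottom c b ∉ V)
               (found : firstNewᴸ (descendingExcept (fromBottom c) c c) V ≡ just (fromBottom c b))
               (higher : ∀ {b′} → b < b′ → b′ ≤ c → b′ ≢ c → fromBottom c b′ ∈ V) where

    b<c : b < c
    b<c = ≤∧≢⇒< b≤c b≢c

    entry≤ : M ∸ c < M ∸ b
    entry≤ = ∸-monoʳ-< b<c c≤M

    module S = Sweep b {M ∸ b} {M ∸ c} refl (<⇒≤ entry≤)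

    entry : fromBottom c b ≡ appendOne b (special K (M ∸ b) (M ∸ c))
    entry = cong (appendOne b) (prefix-special K (M ∸ c) 0 c b (m∸n+n≡m c≤M))

    avoided : LevelAvoided V b
    avoided with settled b<c
    ... | inj₁ covered = ⊥-elim (b∉ (subst (_∈ V) (sym entry) (covered (special∈F K (<⇒≤ entry≤)))))
    ... | inj₂ avoided = avoided

    D : Descent b (S.after V)
    D = descent′ b<c (≤-trans (<⇒≤ b<c) c≤M) (S.exhausted (S.last-bottom entry≤)) λ b′<b →
      [ inj₁ ∘ covered-⊆ S.keeps , inj₂ ∘ S.keeps-avoided (<⇒≢ b′<b) ]′ (settled (<-trans b′<b b<c))

    covers-below : ∀ {b′} → b′ < c → LevelCovered (Descent.visited D) b′
    covers-below {b′} b′<c with <-cmp b′ b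
    ... | tri< b′<b _ _ = Descent.covers-below D b′<b
    ... | tri≈ _ refl _ = covered-⊆ (run-⊆ (Descent.run D)) S.covers-level
    ... | tri> _ _ b<b′ with settled b′<c
    ...   | inj₁ covered = covered-⊆ (run-⊆ (Descent.run D) ∘ S.keeps) covered
    ...   | inj₂ avoided′ = ⊥-elim (avoided′ (higher b<b′ (<⇒≤ b′<c) (<⇒≢ b′<c)) (trailingZeros-fromBottom c b′))

    last≤b : Descent.lastLevel D ≤ b
    last≤b = [ ≤-reflexive , <⇒≤ ∘ proj₁ ]′ (proj₂ (Descent.stops D))

    stopped : Descent.lastLevel D < c × LevelAvoided V (Descent.lastLevel D)
    stopped with proj₂ (Descent.stops D)
    ... | inj₁ last≡b = subst (_< c) (sym last≡b) b<c , λ z∈ z-level → avoided z∈ (trans z-level last≡b)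
    ... | inj₂ (last<b , avoided′) = <-trans last<b b<c , λ z∈ → avoided′ (S.keeps z∈)

    stops : StopsAt V c (Descent.lastLevel D)
    stops = (λ b′<last → lifted-covers⁻ (<⇒≢ (<-≤-trans b′<last last≤b)) (proj₁ (Descent.stops D) b′<last)) , inj₂ stopped

    descent : Descent c V
    descent = record
      { run = S.enter (trans (firstNew-fromBottom exhausted) (trans found (cong just entry))) avoided
                (subst (λ e → GreedyRun (suc (suc K)) (appendOne b e) (S.after V) (Descent.last D) (Descent.visited D))
                       (sym (S.last-bottom entry≤)) (Descent.run D))
      ; covers-below = covers-below
      ; lastLevel = Descent.lastLevel D ; last≡ = Descent.last≡ D ; stops = stops }

  descent : ∀ c → Acc _<_ c → DescentFrom c
  descent c (acc smaller) {V} c≤M exhausted settled with descendingChoice (fromBottom c) c c V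
  ... | allVisited none visited = descent-stop exhausted settled none visited
  ... | highestUnvisited b b≤c b≢c b∉ found higher =
    Enter.descent (λ b<c → descent _ (smaller b<c)) c≤M exhausted settled b≤c b≢c b∉ found higher

  record Sweeping (x : List Bool) (V : List (List Bool)) (e : List Bool) : Set where
    field
      visited : List (List Bool)
      run : GreedyRun (suc (suc K)) x V e visited
      covers : ∀ {y} → FWord (suc K) M y → y ∈ visited

  Sweeping-from : ∀ {x x′ V e} → x ≡ x′ → Sweeping x′ V e → Sweeping x V e
  Sweeping-from refl S = S

  Sweeping-to : ∀ {x V e e′} → e ≡ e′ → Sweeping x V e → Sweeping x V e′
  Sweeping-to refl S = S

  descent-from-top : ∀ {V} → Exhausted M (bottomWord K (M ∸ M)) V → Settled V M → LevelCovered V M →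
    ∀ {b₀} → StopsAt V M b₀ → Sweeping (bottom M) V (bottom b₀)
  descent-from-top {V} exhausted settled top-covered {b₀} b₀-stops = record
    { run = subst (λ e → GreedyRun (suc (suc K)) (bottom M) V e (Descent.visited D))
                  (trans (Descent.last≡ D) (cong bottom (StopsAt-unique (Descent.stops D) b₀-stops))) (Descent.run D)
    ; covers = all-covered }
    where
    D : Descent M V
    D = descent M (<-wellFounded M) ≤-refl exhausted settled
    all-covered : ∀ {y} → FWord (suc K) M y → y ∈ Descent.visited D
    all-covered y∈F with FWord-appendOne⁻ y∈F
    ... | c , q , c≤M , q∈F , refl with m≤n⇒m<n∨m≡n c≤M
    ...   | inj₁ c<M = Descent.covers-below D c<M q∈F
    ...   | inj₂ refl = run-⊆ (Descent.run D) (top-covered q∈F)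

  toTraversal : ∀ {i} → Sweeping (special (suc K) M i) (special (suc K) M i ∷ []) (special (suc K) M (lastIndex (suc K) M i)) →
                Traversal (suc K) M i
  toTraversal S = record { run = Sweeping.run S ; covers = Sweeping.covers S ; last≡ = refl }

  module FirstLevel {i} (i≤M : i ≤ M) where
    c₀ : ℕ
    c₀ = M ∸ i

    module S₀ = Sweep c₀ {i} {i} (m∸[m∸n]≡n i≤M) ≤-refl

    V₁ : List (List Bool)
    V₁ = S₀.after []

    start : ∀ {e} → Sweeping (appendOne c₀ (last S₀.T)) V₁ e → Sweeping (special (suc K) M i) (special (suc K) M i ∷ []) e
    start {e} S = record
      { run = subst (λ w → GreedyRun (suc (suc K)) w (w ∷ []) e (Sweeping.visited S)) (sym start≡)
                    (run-lifted (run S₀.T) (FWord⇒inFᴸ (special∈F K (≤-refl {i}))) (λ ()) (Sweeping.run S))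
      ; covers = Sweeping.covers S }
      where
      start≡ : special (suc K) M i ≡ appendOne c₀ (special K i i)
      start≡ = trans (special-suc K M i) (cong (appendOne c₀) (sym (special-bottom K i)))

    last₀ : last S₀.T ≡ special K i (lastIndexFromBottom K i)
    last₀ = trans S₀.last-from-bottom (cong (special K i) (lastIndex-bottom K i))

  below-top : ∀ {i} → suc i ≤ M → M ∸ suc i < M
  below-top {i} i<M = subst (M ∸ suc i <_) (trans (+-comm (suc i) (M ∸ suc i)) (m∸n+n≡m i<M)) (m<n+m (M ∸ suc i) (s≤s z≤n))

  traversal-top : Traversal (suc K) M 0
  traversal-top = toTraversal (start (Sweeping-from (cong (appendOne M) (trans last₀ (cong (bottomWord K) (sym (n∸n≡0 M)))))
    (Sweeping-to (trans (bottom≡special z≤n) (cong (special (suc K) M) (sym (lastIndex-zero (suc K) M))))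
      (descent-from-top (subst (λ a → Exhausted M (bottomWord K a) V₁) (sym (n∸n≡0 M)) (S₀.exhausted last₀))
                        (λ b<M → inj₂ (S₀.only-level (<⇒≢ b<M))) S₀.covers-level stops))))
    where
    open FirstLevel z≤n
    stops : StopsAt V₁ M 0
    stops with M ≟ 0
    ... | yes M≡0 = (λ ()) , inj₁ (sym M≡0)
    ... | no M≢0 = (λ ()) , inj₂ (n≢0⇒n>0 M≢0 , S₀.only-level (λ 0≡M → M≢0 (sym 0≡M)))

  -- For odd K the first level ends at its top word, whose last 1 can jump straight to level M.
  module Odd {i} (i<M : suc i ≤ M) (odd : endsOnTop K ≡ true) where
    open FirstLevel i<M

    last₀′ : last S₀.T ≡ special K (suc i) 0
    last₀′ = trans last₀ (cong (λ t → special K (suc i) (if t then 0 else i)) odd)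

    c₀<M : c₀ < M
    c₀<M = below-top i<M

    n : ℕ
    n = suc i + c₀
    n≡M : n ≡ M
    n≡M = trans (+-comm (suc i) c₀) (m∸n+n≡m i<M)

    target : ℕ → List Bool
    target = λ b → appendOne b (specialPrefix K 0 ++ true ∷ 0ⁿ (n ∸ b))

    first : firstNewᴸ (candidates (suc (suc K)) (appendOne c₀ (special K (suc i) 0))) V₁ ≡ just (appendOne M (special K 0 0))
    first = trans (firstNewᴸ-lastOne (prefix-lastOne K 0 (suc i)) (S₀.exhausted last₀′))
           (trans (firstNewᴸ-highest target (>⇒≢ (subst (c₀ <_) (sym n≡M) c₀<M))
                    (λ t∈ → S₀.only-level (>⇒≢ c₀<M) t∈ (trans (trailingZeros-appendOne n (specialPrefix K 0 ++ true ∷ 0ⁿ (n ∸ n))) n≡M)))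
                  (cong just (cong₂ (λ l m → appendOne l (specialPrefix K 0 ++ true ∷ 0ⁿ m)) n≡M (n∸n≡0 n))))

    module S = Sweep M {0} {0} (n∸n≡0 M) z≤n

    V₂ : List (List Bool)
    V₂ = S.after V₁

    settled : Settled V₂ M
    settled {b} b<M with b ≟ c₀
    ... | yes refl = inj₁ (covered-⊆ S.keeps S₀.covers-level)
    ... | no b≢c₀ = inj₂ (S.keeps-avoided (<⇒≢ b<M) (S₀.only-level b≢c₀))

    stops-ending : Σ ℕ λ b₀ → StopsAt V₂ M b₀ × bottom b₀ ≡ special (suc K) M (lastIndex (suc K) M (suc i))
    stops-ending with c₀ ≟ 0
    ... | yes c₀≡0 = 1 , (level0 , stop1) , trans (bottom≡special 1≤M) (cong (special (suc K) M) (sym (begin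
        lastIndex (suc K) M (suc i)          ≡⟨ lastIndex-full (suc K) i<M c₀≡0 ⟩
        lastIndexFromBottom (suc K) M        ≡⟨ lastIndexFromBottom-suc K 1≤M ⟩
        (if endsOnTop K then pred M else 0)  ≡⟨ cong (λ t → if t then pred M else 0) odd ⟩
        M ∸ 1                                ∎)))
      where
      open ≡-Reasoning
      1≤M : 1 ≤ M
      1≤M = ≤-trans (s≤s z≤n) i<M
      level0 : ∀ {b} → b < 1 → LevelCovered V₂ b
      level0 (s≤s z≤n) = subst (LevelCovered V₂) c₀≡0 (covered-⊆ S.keeps S₀.covers-level)
      stop1 : 1 ≡ M ⊎ (1 < M × LevelAvoided V₂ 1)
      stop1 with M ≟ 1
      ... | yes M≡1 = inj₁ (sym M≡1)
      ... | no M≢1 = inj₂ (≤∧≢⇒< 1≤M (M≢1 ∘ sym) , S.keeps-avoided (M≢1 ∘ sym) (S₀.only-level λ 1≡c₀ → 1+n≢0 (trans 1≡c₀ c₀≡0)))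
    ... | no c₀≢0 = 0 , ((λ ()) , inj₂ (0<M , S.keeps-avoided (<⇒≢ 0<M) (S₀.only-level (c₀≢0 ∘ sym)))) ,
                    trans (bottom≡special z≤n) (cong (special (suc K) M) (sym (lastIndex-partial (suc K) c₀≢0)))
      where
      0<M : 0 < M
      0<M = ≤-trans (s≤s z≤n) c₀<M

    traversal′ : Traversal (suc K) M (suc i)
    traversal′ = toTraversal (start (Sweeping-from (cong (appendOne c₀) last₀′) (record
      { run = S.enter first (S₀.only-level (>⇒≢ c₀<M))
                (subst (λ e → GreedyRun (suc (suc K)) (appendOne M e) V₂ _ (Sweeping.visited final)) (sym last-top) (Sweeping.run final))
      ; covers = Sweeping.covers final })))
      where
      last-top : last S.T ≡ bottomWord K (M ∸ M)
      last-top = trans S.last-from-bottom (cong (bottomWord K) (sym (n∸n≡0 M)))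
      final : Sweeping (bottom M) V₂ (special (suc K) M (lastIndex (suc K) M (suc i)))
      final = Sweeping-to (proj₂ (proj₂ stops-ending))
        (descent-from-top (S.exhausted last-top) settled S.covers-level (proj₁ (proj₂ stops-ending)))

  record Climbed (c : ℕ) (V : List (List Bool)) (x : List Bool) : Set where
    field
      reached : List (List Bool)
      V⊆reached : V ⊆ reached
      covered-above : ∀ {b} → c < b → b ≤ M → LevelCovered reached b
      avoided-below : ∀ {b} → b ≤ c → LevelAvoided V b → LevelAvoided reached b
      exhausted-at-top : Exhausted M (bottomWord K (M ∸ M)) reached
      prepend : ∀ {e} → Sweeping (bottom M) reached e → Sweeping x V e

  module OneLevelUp (a c : ℕ) {V : List (List Bool)} (c+a≡M : c + suc a ≡ M)
                    (exhausted : Exhausted c (special K (suc a) a) V)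
                    (avoided-above : ∀ {b} → c < b → LevelAvoided V b) where

    n : ℕ
    n = (suc a ∸ a) + c
    n≡ : n ≡ suc c
    n≡ = cong (_+ c) (m+n∸n≡m 1 a)

    target : ℕ → List Bool
    target = λ b → appendOne b (specialPrefix K a ++ true ∷ 0ⁿ (n ∸ b))

    first : firstNewᴸ (candidates (suc (suc K)) (appendOne c (special K (suc a) a))) V ≡ just (appendOne (suc c) (special K a a))
    first = trans (firstNewᴸ-lastOne (prefix-lastOne K a (suc a ∸ a)) exhausted)
           (trans (firstNewᴸ-highest target (>⇒≢ c<n) (λ t∈ → avoided-above c<n t∈ (trailingZeros-appendOne n (specialPrefix K a ++ true ∷ 0ⁿ (n ∸ n)))))
                  (cong just (cong₂ (λ l m → appendOne l (specialPrefix K a ++ true ∷ 0ⁿ m)) n≡ (trans (n∸n≡0 n) (sym (n∸n≡0 a))))))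
      where
      c<n : c < n
      c<n = subst (c <_) (sym n≡) (n<1+n c)

    M∸sc : M ∸ suc c ≡ a
    M∸sc = trans (cong (_∸ suc c) (trans (sym c+a≡M) (+-suc c a))) (m+n∸m≡n (suc c) a)

    module S = Sweep (suc c) {a} {a} M∸sc ≤-refl

    V₂ : List (List Bool)
    V₂ = S.after V

    enter : ∀ {e R} → GreedyRun (suc (suc K)) (appendOne (suc c) (last S.T)) V₂ e R →
            GreedyRun (suc (suc K)) (appendOne c (special K (suc a) a)) V e R
    enter = S.enter first (avoided-above (n<1+n c))

    keeps-avoided : ∀ {b} → b ≤ c → LevelAvoided V b → LevelAvoided V₂ b
    keeps-avoided b≤c = S.keeps-avoided (<⇒≢ (s≤s b≤c))

    last′ : last S.T ≡ special K a (lastIndexFromBottom K a)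
    last′ = trans S.last-from-bottom (cong (special K a) (lastIndex-bottom K a))

  -- For even K each level ends one step above its bottom, from where the last 1 climbs one level.
  climb : endsOnTop K ≡ false → ∀ a {c V} → c + suc a ≡ M → Exhausted c (special K (suc a) a) V →
    (∀ {b} → c < b → LevelAvoided V b) → Climbed c V (appendOne c (special K (suc a) a))
  climb even zero {c} {V} c+a≡M exhausted avoided-above = record
    { reached = V₂ ; V⊆reached = S.keeps
    ; covered-above = λ {b} c<b b≤M → subst (LevelCovered V₂) (sym (≤-antisym (subst (b ≤_) (sym sc≡M) b≤M) c<b)) S.covers-level
    ; avoided-below = keeps-avoided
    ; exhausted-at-top = subst₂ (λ l m → Exhausted l (bottomWord K m) V₂) sc≡M (sym (n∸n≡0 M)) (S.exhausted last′)
    ; prepend = λ R → record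
        { run = enter (subst (λ x → GreedyRun (suc (suc K)) x V₂ _ (Sweeping.visited R)) bottom≡ (Sweeping.run R))
        ; covers = Sweeping.covers R } }
    where
    open OneLevelUp 0 c c+a≡M exhausted avoided-above
    sc≡M : suc c ≡ M
    sc≡M = trans (cong suc (sym (+-identityʳ c))) (trans (sym (+-suc c 0)) c+a≡M)
    bottom≡ : bottom M ≡ appendOne (suc c) (last S.T)
    bottom≡ = cong₂ appendOne (sym sc≡M) (trans (cong (bottomWord K) (n∸n≡0 M)) (sym last′))
  climb even (suc a) {c} {V} c+a≡M exhausted avoided-above = record
    { reached = Climbed.reached C ; V⊆reached = Climbed.V⊆reached C ∘ S.keeps
    ; covered-above = covered-above
    ; avoided-below = λ b≤c avoided → Climbed.avoided-below C (m≤n⇒m≤1+n b≤c) (keeps-avoided b≤c avoided)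
    ; exhausted-at-top = Climbed.exhausted-at-top C
    ; prepend = λ R → let R′ = Climbed.prepend C R in record
        { run = enter (subst (λ e → GreedyRun (suc (suc K)) (appendOne (suc c) e) V₂ _ (Sweeping.visited R′)) (sym last″) (Sweeping.run R′))
        ; covers = Sweeping.covers R′ } }
    where
    open OneLevelUp (suc a) c c+a≡M exhausted avoided-above
    last″ : last S.T ≡ special K (suc a) a
    last″ = trans last′ (cong (λ t → special K (suc a) (if t then 0 else a)) even)
    C : Climbed (suc c) V₂ (appendOne (suc c) (special K (suc a) a))
    C = climb even a {suc c} {V₂} (trans (sym (+-suc c (suc a))) c+a≡M) (S.exhausted last″)
          λ sc<b → S.keeps-avoided (>⇒≢ sc<b) (avoided-above (<-trans (n<1+n c) sc<b))
    covered-above : ∀ {b} → c < b → b ≤ M → LevelCovered (Climbed.reached C) b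
    covered-above {b} c<b b≤M with m≤n⇒m<n∨m≡n c<b
    ... | inj₂ refl = covered-⊆ (Climbed.V⊆reached C) S.covers-level
    ... | inj₁ sc<b = Climbed.covered-above C sc<b b≤M

  module Even {i} (i<M : suc i ≤ M) (even : endsOnTop K ≡ false) where
    open FirstLevel i<M

    last₀′ : last S₀.T ≡ special K (suc i) i
    last₀′ = trans last₀ (cong (λ t → special K (suc i) (if t then 0 else i)) even)

    c₀<M : c₀ < M
    c₀<M = below-top i<M

    C : Climbed c₀ V₁ (appendOne c₀ (special K (suc i) i))
    C = climb even i {c₀} {V₁} (m∸n+n≡m i<M) (S₀.exhausted last₀′) (λ c₀<b → S₀.only-level (>⇒≢ c₀<b))
    W : List (List Bool)
    W = Climbed.reached C

    covered-from : ∀ {b} → c₀ ≤ b → b ≤ M → LevelCovered W b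
    covered-from {b} c₀≤b b≤M with m≤n⇒m<n∨m≡n c₀≤b
    ... | inj₁ c₀<b = Climbed.covered-above C c₀<b b≤M
    ... | inj₂ refl = covered-⊆ (Climbed.V⊆reached C) S₀.covers-level

    settled : Settled W M
    settled {b} b<M with b <? c₀
    ... | yes b<c₀ = inj₂ (Climbed.avoided-below C (<⇒≤ b<c₀) (S₀.only-level (<⇒≢ b<c₀)))
    ... | no b≮c₀ = inj₁ (covered-from (≮⇒≥ b≮c₀) (<⇒≤ b<M))

    stops-ending : Σ ℕ λ b₀ → StopsAt W M b₀ × bottom b₀ ≡ special (suc K) M (lastIndex (suc K) M (suc i))
    stops-ending with c₀ ≟ 0
    ... | yes c₀≡0 = M , ((λ {b} b<M → covered-from (subst (_≤ b) (sym c₀≡0) z≤n) (<⇒≤ b<M)) , inj₁ refl) ,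
      trans (bottom≡special ≤-refl) (cong (special (suc K) M) (begin
        M ∸ M                                ≡⟨ n∸n≡0 M ⟩
        0                                    ≡⟨ cong (λ t → if t then pred M else 0) even ⟨
        (if endsOnTop K then pred M else 0)  ≡⟨ lastIndexFromBottom-suc K (≤-trans (s≤s z≤n) i<M) ⟨
        lastIndexFromBottom (suc K) M        ≡⟨ lastIndex-full (suc K) i<M c₀≡0 ⟨
        lastIndex (suc K) M (suc i)          ∎))
      where open ≡-Reasoning
    ... | no c₀≢0 = 0 , ((λ ()) , inj₂ (≤-trans (s≤s z≤n) c₀<M , Climbed.avoided-below C z≤n (S₀.only-level (c₀≢0 ∘ sym)))) ,
                    trans (bottom≡special z≤n) (cong (special (suc K) M) (sym (lastIndex-partial (suc K) c₀≢0)))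

    traversal′ : Traversal (suc K) M (suc i)
    traversal′ = toTraversal (start (Sweeping-from (cong (appendOne c₀) last₀′) (Climbed.prepend C
      (Sweeping-to (proj₂ (proj₂ stops-ending))
        (descent-from-top (Climbed.exhausted-at-top C) settled (covered-from (<⇒≤ c₀<M) ≤-refl) (proj₁ (proj₂ stops-ending)))))))

  traversal-suc : ∀ {i} → i ≤ M → Traversal (suc K) M i
  traversal-suc {zero} _ = traversal-top
  traversal-suc {suc i} i<M with endsOnTop K in parity
  ... | true = Odd.traversal′ i<M parity
  ... | false = Even.traversal′ i<M parity

traversal : ∀ K M {i} → i ≤ M → Traversal K M i
traversal zero M = traversal-zero M
traversal (suc K) M = Step.traversal-suc K (λ a → traversal K a) M

-- Runs from the other words

record Trapped (K M : ℕ) (x : List Bool) : Set where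
  field
    last : List Bool
    visited : List (List Bool)
    run : GreedyRun (suc K) x (x ∷ []) last visited
    stays-low : ∀ {z} → z ∈ visited → trailingZeros z ≤ trailingZeros x
    low : trailingZeros x < M
    last-bottom : trailingZeros last ≡ 0

IsSpecial : ℕ → ℕ → List Bool → Set
IsSpecial K M x = ∃ λ i → i ≤ M × x ≡ special K M i

module NonSpecialStep (K : ℕ) (special-or-trapped : ∀ {a x} → FWord K a x → IsSpecial K a x ⊎ Trapped K a x) (M : ℕ) where

  record ToBottom (q : List Bool) : Set where
    field
      last : List Bool
      visited : List (List Bool)
      run : GreedyRun (suc K) q (q ∷ []) last visited
      last-bottom : trailingZeros last ≡ 0

  to-bottom : ∀ {a q} → FWord K a q → 1 ≤ trailingZeros q → ToBottom q
  to-bottom {a} q∈F q-level with special-or-trapped q∈F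
  ... | inj₂ stuck = record { run = Trapped.run stuck ; last-bottom = Trapped.last-bottom stuck }
  ... | inj₁ (j , j≤a , refl) = record
    { run = Traversal.run swept
    ; last-bottom = begin
        trailingZeros (Traversal.last swept)  ≡⟨ cong trailingZeros (trans (Traversal.last≡ swept) (cong (special K a) (lastIndex-< K j<a))) ⟩
        trailingZeros (special K a a)     ≡⟨ trailingZeros-special K a a ⟩
        a ∸ a                             ≡⟨ n∸n≡0 a ⟩
        0                                 ∎ }
    where
    open ≡-Reasoning
    j<a : j < a
    j<a = ≰⇒> λ a≤j → <⇒≱ q-level (≤-reflexive (trans (trailingZeros-special K a j) (m≤n⇒m∸n≡0 a≤j)))
    swept : Traversal K a j
    swept = traversal K a (<⇒≤ j<a)

  record Descends (c : ℕ) (e : List Bool) (V : List (List Bool)) : Set where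
    field
      last : List Bool
      visited : List (List Bool)
      run : GreedyRun (suc (suc K)) (appendOne c e) V last visited
      last-bottom : trailingZeros last ≡ 0
      new-below : ∀ {z} → z ∈ visited → z ∈ V ⊎ trailingZeros z < c

  -- From the bottom of level c the last 1 moves one level down, into a word that is not at the
  -- bottom of its level; its lower run then reaches the bottom again.
  descends : ∀ c {e V} → c ≤ M → FWord K (M ∸ c) e → trailingZeros e ≡ 0 →
    map (appendOne c) (candidates (suc K) e) ⊆ V → (∀ {z} → z ∈ V → c ≤ trailingZeros z) → Descends c e V
  descends zero {e} {V} _ e∈F e-level done _ = record
    { run = stop (firstNewᴸ-lastOne (lastOne-bottom e∈F e-level) done)
    ; last-bottom = trailingZeros-appendOne 0 e ; new-below = inj₁ }
  descends (suc c) {e} {V} c<M e∈F e-level done high = record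
    { run = step first (run-lifted (ToBottom.run B) (FWord⇒inFᴸ q∈F) avoided (Descends.run D))
    ; last-bottom = Descends.last-bottom D
    ; new-below = λ z∈ → case Descends.new-below D z∈ of λ
        { (inj₂ z<c) → inj₂ (m≤n⇒m≤1+n z<c)
        ; (inj₁ z∈V₂) → case ∈-++⁻ (map (appendOne c) (ToBottom.visited B)) z∈V₂ of λ
            { (inj₁ z∈map) → inj₂ (≤-reflexive (cong suc (∈-map-appendOne z∈map)))
            ; (inj₂ z∈V) → inj₁ z∈V } } }
    where
    D₀ : LastOne K e
    D₀ = lastOne-bottom e∈F e-level
    r : List Bool
    r = LastOne.prefix D₀
    q : List Bool
    q = r ++ true ∷ 0ⁿ 1
    target : ℕ → List Bool
    target = λ b → appendOne b (r ++ true ∷ 0ⁿ (suc c ∸ b))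
    target-c : target c ≡ appendOne c q
    target-c = cong (λ d → appendOne c (r ++ true ∷ 0ⁿ d)) (m+n∸n≡m 1 c)
    avoided : LevelAvoided V c
    avoided z∈ z-level = <-irrefl (sym z-level) (high z∈)
    first : firstNewᴸ (candidates (suc (suc K)) (appendOne (suc c) e)) V ≡ just (appendOne c q)
    first = trans (firstNewᴸ-lastOne D₀ done)
           (trans (cong (λ l → firstNewᴸ l V) (descendingExcept-skip target c))
           (trans (firstNewᴸ-highest target (<⇒≢ (n<1+n c)) (λ t∈ → avoided t∈ (trailingZeros-appendOne c (r ++ true ∷ 0ⁿ (suc c ∸ c)))))
                  (cong just target-c)))
    q∈F : FWord K (M ∸ c) q
    q∈F = subst (λ a → FWord K a q) (sym (+-∸-assoc 1 c<M))
                (FWord-shift (subst (FWord K (M ∸ suc c)) (LastOne.split D₀) e∈F))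
    B : ToBottom q
    B = to-bottom q∈F (≤-reflexive (sym (trailingZeros-1∷0ⁿ r 1)))
    V₂ : List (List Bool)
    V₂ = map (appendOne c) (ToBottom.visited B) ++ V
    D : Descends c (ToBottom.last B) V₂
    D = descends c (≤-trans (n≤1+n c) c<M) (run-FWord (ToBottom.run B) q∈F) (ToBottom.last-bottom B)
          (run-lifted-end (ToBottom.run B) V)
          λ z∈ → case ∈-++⁻ (map (appendOne c) (ToBottom.visited B)) z∈ of λ
            { (inj₁ z∈map) → ≤-reflexive (sym (∈-map-appendOne z∈map))
            ; (inj₂ z∈V) → ≤-trans (n≤1+n c) (high z∈V) }

  trapped : ∀ {c q} → c < M → FWord K (M ∸ c) q → ToBottom q → Trapped (suc K) M (appendOne c q)
  trapped {c} {q} c<M q∈F B = record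
    { run = run-lifted (ToBottom.run B) (FWord⇒inFᴸ q∈F) (λ ()) (Descends.run D)
    ; stays-low = λ z∈ → subst (_ ≤_) (sym (trailingZeros-appendOne c q)) (case Descends.new-below D z∈ of λ
        { (inj₁ z∈V) → ≤-reflexive (∈-map-appendOne (subst (_ ∈_) (++-identityʳ _) z∈V))
        ; (inj₂ z<c) → <⇒≤ z<c })
    ; low = subst (_< M) (sym (trailingZeros-appendOne c q)) c<M
    ; last-bottom = Descends.last-bottom D }
    where
    V : List (List Bool)
    V = map (appendOne c) (ToBottom.visited B) ++ []
    D : Descends c (ToBottom.last B) V
    D = descends c (<⇒≤ c<M) (run-FWord (ToBottom.run B) q∈F) (ToBottom.last-bottom B) (run-lifted-end (ToBottom.run B) [])
          λ z∈ → ≤-reflexive (sym (∈-map-appendOne (subst (_ ∈_) (++-identityʳ _) z∈)))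

  positive⇒< : ∀ {c} → 0 < M ∸ c → c < M
  positive⇒< {c} pos = ≰⇒> λ M≤c → <⇒≢ pos (sym (m≤n⇒m∸n≡0 M≤c))

  special-or-trapped-suc : ∀ {x} → FWord (suc K) M x → IsSpecial (suc K) M x ⊎ Trapped (suc K) M x
  special-or-trapped-suc x∈F with FWord-appendOne⁻ x∈F
  ... | c , q , c≤M , q∈F , refl with special-or-trapped q∈F
  ...   | inj₂ stuck = inj₂ (trapped (positive⇒< (≤-trans (s≤s z≤n) (Trapped.low stuck))) q∈F
                                  (record { run = Trapped.run stuck ; last-bottom = Trapped.last-bottom stuck }))
  ...   | inj₁ (j , j≤a , refl) with j ≟ M ∸ c
  ...     | yes refl = inj₁ (M ∸ c , m∸n≤m M c , sym (trans (special-suc K M (M ∸ c))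
                          (cong₂ appendOne (m∸[m∸n]≡n c≤M) (sym (special-bottom K (M ∸ c))))))
  ...     | no j≢a = inj₂ (trapped (positive⇒< (≤-trans (s≤s z≤n) j<a)) q∈F
                               (to-bottom q∈F (subst (1 ≤_) (sym (trailingZeros-special K (M ∸ c) j)) (m<n⇒0<n∸m j<a))))
    where
    j<a : j < M ∸ c
    j<a = ≤∧≢⇒< j≤a j≢a

special-or-trapped : ∀ K {M x} → FWord K M x → IsSpecial K M x ⊎ Trapped K M x
special-or-trapped zero x∈F = inj₁ (FWord-zero⁻ x∈F)
special-or-trapped (suc K) {M} = NonSpecialStep.special-or-trapped-suc K (special-or-trapped K) M

∈-greedyF : ∀ {n k} (α : Word n) {e R} → GreedyRun k (toList α) (toList α ∷ []) e R →
  ∀ β → β ∈ greedyF n k α ⇔ toList β ∈ R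
∈-greedyF {n} {k} α {e} {R} r β = mk⇔
  (λ β∈ → subst (toList β ∈_) loop≡R (∈-map⁺ toList (Any.reverse⁻ β∈)))
  (λ β∈R → Any.reverse⁺ (∈-map-toList⁻ (subst (toList β ∈_) (sym loop≡R) β∈R)))
  where
  -- a run never repeats a word, so it has at most 2ⁿ steps
  enough-fuel : steps r ≤ 2 ^ n
  enough-fuel = ≤-trans (m≤m+n (steps r) 1) (≤-trans (≤-reflexive (sym (run-length r)))
    (unique-words-length n (run-unique r (All.[] AllPairs.∷ AllPairs.[])) (run-wordLengths r (length-toList α) (length-toList α All.∷ All.[]))))
  loop≡R : map toList (greedyLoop k (2 ^ n) α (α ∷ [])) ≡ R
  loop≡R = greedyLoop-run k r (2 ^ n) enough-fuel α (α ∷ []) refl refl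

module Generators (n K : ℕ) (2k-1≤n : 2 * suc K ∸ 1 ≤ n) where

  M : ℕ
  M = n ∸ (2 * suc K ∸ 1)

  length≡ : suc (K + K) + M ≡ n
  length≡ = trans (cong (_+ M) (sym 2k-1≡)) (m+[n∸m]≡n 2k-1≤n)
    where
    2k-1≡ : 2 * suc K ∸ 1 ≡ suc (K + K)
    2k-1≡ = trans (cong (λ x → K + suc x) (+-identityʳ K)) (+-suc K K)

  InF⇒FWord : ∀ {α} → InF n (suc K) α → FWord K M (toList α)
  InF⇒FWord {α} (weight≡ , noAdj≡) = fword (trans (sym (weight-toList α)) weight≡) noAdj≡ (trans (length-toList α) (sym length≡))

  FWord⇒InF : ∀ {α} → FWord K M (toList α) → InF n (suc K) α
  FWord⇒InF {α} (fword weight≡ noAdj≡ _) = trans (weight-toList α) weight≡ , noAdj≡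

  specialVec : Fin (suc M) → Word n
  specialVec i = cast (trans (FWord.length≡ (special∈F K (≤-pred (toℕ<n i)))) length≡) (fromList (special K M (toℕ i)))

  toList-specialVec : ∀ i → toList (specialVec i) ≡ special K M (toℕ i)
  toList-specialVec i = trans (toList-cast _ _) (toList∘fromList _)

  specialVec-injective : ∀ {i j} → specialVec i ≡ specialVec j → i ≡ j
  specialVec-injective {i} {j} eq = toℕ-injective (special-injective K (≤-pred (toℕ<n i)) (≤-pred (toℕ<n j))
    (trans (sym (toList-specialVec i)) (trans (cong toList eq) (toList-specialVec j))))

  IsSpecialWord : Word n → Set
  IsSpecialWord α = ∃[ i ] (i ≤ M × toList α ≡ specialWord n (suc K) i)

  generators : (α : Word n) → GenF n (suc K) α ⇔ IsSpecialWord α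
  generators α = mk⇔ to from
    where
    to : GenF n (suc K) α → IsSpecialWord α
    to (α∈F , generates) with special-or-trapped K (InF⇒FWord α∈F)
    ... | inj₁ (i , i≤M , eq) = i , i≤M , trans eq (sym (specialWord≡special n K i))
    ... | inj₂ stuck = ⊥-elim (<⇒≱ (Trapped.low stuck) (begin
      M                                  ≡⟨ sym (trailingZeros-special K M 0) ⟩
      trailingZeros (special K M 0)      ≡⟨ cong trailingZeros (toList-specialVec Fin.zero) ⟨
      trailingZeros (toList top)         ≤⟨ Trapped.stays-low stuck top∈ ⟩
      trailingZeros (toList α)           ∎))
      where
      open ≤-Reasoning
      top : Word n
      top = specialVec Fin.zero
      top∈ : toList top ∈ Trapped.visited stuck
      top∈ = Equivalence.to (∈-greedyF α (Trapped.run stuck) top)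
               (generates top (FWord⇒InF (subst (FWord K M) (sym (toList-specialVec Fin.zero)) (special∈F K z≤n))))
    from : IsSpecialWord α → GenF n (suc K) α
    from (i , i≤M , eq) = FWord⇒InF (subst (FWord K M) (sym α≡) (special∈F K i≤M)) , λ β β∈F →
      Equivalence.from (∈-greedyF α run-α β)
                       (Traversal.covers swept (InF⇒FWord β∈F))
      where
      α≡ : toList α ≡ special K M i
      α≡ = trans eq (specialWord≡special n K i)
      swept : Traversal K M i
      swept = traversal K M i≤M
      run-α : GreedyRun (suc K) (toList α) (toList α ∷ []) (Traversal.last swept) (Traversal.visited swept)
      run-α = subst (λ w → GreedyRun (suc K) w (w ∷ []) (Traversal.last swept) (Traversal.visited swept)) (sym α≡) (Traversal.run swept)

  generatorList : List (Word n)
  generatorList = map specialVec (allFin (suc M))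

  ∈-generatorList : (α : Word n) → α ∈ generatorList ⇔ GenF n (suc K) α
  ∈-generatorList α = mk⇔ to from
    where
    to : α ∈ generatorList → GenF n (suc K) α
    to α∈ with i , _ , refl ← ∈-map⁻ specialVec α∈ = Equivalence.from (generators α)
      (toℕ i , ≤-pred (toℕ<n i) , trans (toList-specialVec i) (sym (specialWord≡special n K (toℕ i))))
    from : GenF n (suc K) α → α ∈ generatorList
    from gen with i , i≤M , eq ← Equivalence.to (generators α) gen =
      subst (_∈ generatorList) (sym (toList-inj α≡)) (∈-map⁺ specialVec (∈-allFin j))
      where
      j : Fin (suc M)
      j = fromℕ< (s≤s i≤M)
      α≡ : toList α ≡ toList (specialVec j)
      α≡ = trans eq (trans (specialWord≡special n K i) (sym (trans (toList-specialVec j) (cong (special K M) (toℕ-fromℕ< (s≤s i≤M))))))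

  length-generatorList : length generatorList ≡ n + 2 ∸ 2 * suc K
  length-generatorList = begin
    length generatorList        ≡⟨ trans (length-map specialVec (allFin (suc M))) (length-tabulate (λ i → i)) ⟩
    suc M                       ≡⟨ m+n∸m≡n (2 * suc K) (suc M) ⟨
    2 * suc K + suc M ∸ 2 * suc K  ≡⟨ cong (_∸ 2 * suc K) (arith K M) ⟩
    suc (K + K) + M + 2 ∸ 2 * suc K  ≡⟨ cong (λ m → m + 2 ∸ 2 * suc K) length≡ ⟩
    n + 2 ∸ 2 * suc K          ∎
    where
    open ≡-Reasoning
    arith : ∀ K M → 2 * suc K + suc M ≡ suc (K + K) + M + 2
    arith = solve-∀

proposition8 : (n k : ℕ) → 1 ≤ n → 1 ≤ k → 2 * k ∸ 1 ≤ n →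
    ((α : Word n) → GenF n k α ⇔ (∃[ i ] (i ≤ n ∸ (2 * k ∸ 1) × toList α ≡ specialWord n k i)))
    × (∃[ L ] (Unique L × ((α : Word n) → α ∈ L ⇔ GenF n k α) × length L ≡ n + 2 ∸ 2 * k))
proposition8 n (suc K) _ _ 2k-1≤n =
  generators , generatorList , map⁺ specialVec-injective (allFin⁺ (suc M)) , ∈-generatorList , length-generatorList
  where open Generators n K 2k-1≤n
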